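{- Let $\mathcal{C}$ be a cd-category with effect conditioning, and let $\omega\colon I\to X_1\otimes\cdots\otimes X_n$ be a state. For pairwise disjoint subsets $A,B,C\subseteq\{1,\dots,n\}$ write $(A\perp\!\!\!\perp B\mid C)_\omega$ for conditional independence as defined below. Then for all pairwise disjoint subsets $A,B,C,D\subseteq\{1,\dots,n\}$ the following (semi-graphoid axioms) hold: (Symmetry) $(A\perp\!\!\!\perp B\mid C)_\omega \iff (B\perp\!\!\!\perp A\mid C)_\omega$; (Decomposition) $(A\perp\!\!\!\perp B\cup D\mid C)_\omega \implies (A\perp\!\!\!\perp B\mid C)_\omega$ and $(A\perp\!\!\!\perp D\mid C)_\omega$; (Weak union) $(A\perp\!\!\!\perp B\cup D\mid C)_\omega \implies (A\perp\!\!\!\perp B\mid C\cup D)_\omega$; (Contraction) $(A\perp\!\!\!\perp B\mid C\cup D)_\omega$ and $(A\perp\!\!\!\perp D\mid C)_\omega$ together imply $(A\perp\!\!\!\perp B\cup D\mid C)_\omega$.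
   Context: A cd-category is a symmetric monoidal category $(\mathcal{C},\otimes,I)$ (symmetry $\sigma$) in which every object $X$ carries morphisms $\Delta_X\colon X\to X\otimes X$ (copy) and $\epsilon_X\colon X\to I$ (discard) forming a commutative comonoid, compatible with the tensor: $\Delta_{X\otimes Y}=(\mathrm{id}_X\otimes\sigma_{X,Y}\otimes\mathrm{id}_Y)\circ(\Delta_X\otimes\Delta_Y)$, $\epsilon_{X\otimes Y}=\epsilon_X\otimes\epsilon_Y$, $\Delta_I=\mathrm{id}_I$, $\epsilon_I=\mathrm{id}_I$ (up to unit isomorphisms). A state is a morphism $I\to X$, an effect a morphism $X\to I$. A morphism $f\colon X\to Y$ is a partial channel if $f=(f\otimes(\epsilon_Y\circ f))\circ\Delta_X$. Normalisation: an assignment to each morphism $f\colon X\to Y$ of a partial channel $\mathrm{norm}(f)\colon X\to Y$ such that (N0) $f=(\mathrm{norm}(f)\otimes(\epsilon_Y\circ f))\circ\Delta_X$; (N1) $\mathrm{norm}(f)=f$ whenever $f$ is a partial channel; (N2) $\mathrm{norm}(f\otimes g)=\mathrm{norm}(f)\otimes\mathrm{norm}(g)$; (N3) $\mathrm{norm}(\epsilon_Y\circ f)=\epsilon_Y\circ\mathrm{norm}(f)$; (N4) $\mathrm{norm}(f\circ\Delta_X)=\mathrm{norm}(f)\circ\Delta_X$ for every $f\colon X\otimes X\to Y$. Caps: a choice of effect $\cap_X\colon X\otimes X\to I$ for each $X$, with $\cap_X\circ\sigma_{X,X}=\cap_X$, $\cap_X\circ\Delta_X=\epsilon_X$, $(\cap_X\otimes\mathrm{id}_X)\circ(\mathrm{id}_X\otimes\Delta_X)=(\mathrm{id}_X\otimes\cap_X)\circ(\Delta_X\otimes\mathrm{id}_X)$,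 $\cap_{X\otimes Y}=(\cap_X\otimes\cap_Y)\circ(\mathrm{id}_X\otimes\sigma_{Y,X}\otimes\mathrm{id}_Y)$, $\cap_I=\mathrm{id}_I$. Caps are cancellative if for all $f,g\colon A\to B\otimes X$, $(\mathrm{id}_B\otimes\cap_X)\circ(f\otimes\mathrm{id}_X)=(\mathrm{id}_B\otimes\cap_X)\circ(g\otimes\mathrm{id}_X)$ implies $f=g$. $\mathcal{C}$ has effect conditioning if it has normalisation and cancellative caps. Conditional: for $f\colon X\to Y\otimes Z$, $f|_Z:=\mathrm{norm}\big((\mathrm{id}_Y\otimes\cap_Z)\circ(f\otimes\mathrm{id}_Z)\big)\colon X\otimes Z\to Y$; for a state ($X=I$) this is a morphism $Z\to Y$. Notation: for $S\subseteq\{1,\dots,n\}$ let $X_S=\bigotimes_{i\in S}X_i$ ($X_\emptyset=I$) and $\omega_S$ the marginal of $\omega$ on $X_S$ (discard all other factors). For disjoint $S,T$, $\omega_{S|T}\colon X_T\to X_S$ is the conditional $(\omega_{S\cup T})|_{X_T}$, where $\omega_{S\cup T}$ is regarded (via symmetries) as a state of $X_S\otimes X_T$. Conditional independence: $(A\perp\!\!\!\perp B\mid C)_\omega$ iff $\omega_{A\cup B|C}=(\omega_{A|C}\otimes\omega_{B|C})\circ\Delta_{X_C}$ (identifying $X_{A\cup B}\cong X_A\otimes X_B$). -}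

module Defs where

open import Level using (Level; _⊔_) renaming (suc to lsuc)
open import Relation.Binary using (Rel; IsEquivalence)
open import Data.Nat using (ℕ)
open import Data.Bool using (true; false)
open import Data.Vec using (Vec; []; _∷_; toList)
open import Data.List using (List; []; _∷_)
open import Data.Fin.Subset using (Subset; _∪_; _∩_; Empty)

record CDCategory (o ℓ e : Level) : Set (lsuc (o ⊔ ℓ ⊔ e)) where
  infixr 9 _∘_
  infixr 10 _⊗₁_
  infixr 10 _⊗₀_
  infix 4 _≈_
  infix 4 _⇒_
  field
    Obj : Set o
    _⇒_ : Obj → Obj → Set ℓ
    _≈_ : ∀ {A B} → Rel (A ⇒ B) e
    id  : ∀ {A} → A ⇒ A
    _∘_ : ∀ {A B C} → B ⇒ C → A ⇒ B → A ⇒ C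

    ≈-equiv   : ∀ {A B} → IsEquivalence (_≈_ {A} {B})
    ∘-resp-≈  : ∀ {A B C} {f f′ : B ⇒ C} {g g′ : A ⇒ B} →
                f ≈ f′ → g ≈ g′ → f ∘ g ≈ f′ ∘ g′
    assoc     : ∀ {A B C D} {f : A ⇒ B} {g : B ⇒ C} {h : C ⇒ D} →
                (h ∘ g) ∘ f ≈ h ∘ (g ∘ f)
    identityˡ : ∀ {A B} {f : A ⇒ B} → id ∘ f ≈ f
    identityʳ : ∀ {A B} {f : A ⇒ B} → f ∘ id ≈ f

    I    : Obj
    _⊗₀_ : Obj → Obj → Obj
    _⊗₁_ : ∀ {A B C D} → A ⇒ B → C ⇒ D → (A ⊗₀ C) ⇒ (B ⊗₀ D)
    ⊗-resp-≈ : ∀ {A B C D} {f f′ : A ⇒ B} {g g′ : C ⇒ D} →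
               f ≈ f′ → g ≈ g′ → f ⊗₁ g ≈ f′ ⊗₁ g′
    ⊗-id : ∀ {A B} → id {A} ⊗₁ id {B} ≈ id
    ⊗-∘  : ∀ {A B C D E F} {f : B ⇒ C} {g : A ⇒ B} {h : E ⇒ F} {k : D ⇒ E} →
           (f ∘ g) ⊗₁ (h ∘ k) ≈ (f ⊗₁ h) ∘ (g ⊗₁ k)

    α⇒ : ∀ {A B C} → ((A ⊗₀ B) ⊗₀ C) ⇒ (A ⊗₀ (B ⊗₀ C))
    α⇐ : ∀ {A B C} → (A ⊗₀ (B ⊗₀ C)) ⇒ ((A ⊗₀ B) ⊗₀ C)
    λ⇒ : ∀ {A} → (I ⊗₀ A) ⇒ A
    λ⇐ : ∀ {A} → A ⇒ (I ⊗₀ A)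
    ρ⇒ : ∀ {A} → (A ⊗₀ I) ⇒ A
    ρ⇐ : ∀ {A} → A ⇒ (A ⊗₀ I)
    σ  : ∀ {A B} → (A ⊗₀ B) ⇒ (B ⊗₀ A)

    α-isoˡ : ∀ {A B C} → α⇐ {A} {B} {C} ∘ α⇒ ≈ id
    α-isoʳ : ∀ {A B C} → α⇒ {A} {B} {C} ∘ α⇐ ≈ id
    λ-isoˡ : ∀ {A} → λ⇐ {A} ∘ λ⇒ ≈ id
    λ-isoʳ : ∀ {A} → λ⇒ {A} ∘ λ⇐ ≈ id
    ρ-isoˡ : ∀ {A} → ρ⇐ {A} ∘ ρ⇒ ≈ id
    ρ-isoʳ : ∀ {A} → ρ⇒ {A} ∘ ρ⇐ ≈ id
    σ-invol : ∀ {A B} → σ {B} {A} ∘ σ {A} {B} ≈ id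

    α-natural : ∀ {A A′ B B′ C C′} {f : A ⇒ A′} {g : B ⇒ B′} {h : C ⇒ C′} →
                α⇒ ∘ ((f ⊗₁ g) ⊗₁ h) ≈ (f ⊗₁ (g ⊗₁ h)) ∘ α⇒
    λ-natural : ∀ {A B} {f : A ⇒ B} → λ⇒ ∘ (id {I} ⊗₁ f) ≈ f ∘ λ⇒
    ρ-natural : ∀ {A B} {f : A ⇒ B} → ρ⇒ ∘ (f ⊗₁ id {I}) ≈ f ∘ ρ⇒
    σ-natural : ∀ {A A′ B B′} {f : A ⇒ A′} {g : B ⇒ B′} →
                σ ∘ (f ⊗₁ g) ≈ (g ⊗₁ f) ∘ σ

    triangle : ∀ {A B} → (id {A} ⊗₁ λ⇒ {B}) ∘ α⇒ ≈ ρ⇒ ⊗₁ id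
    pentagon : ∀ {A B C D} →
               (id {A} ⊗₁ α⇒ {B} {C} {D}) ∘ α⇒ ∘ (α⇒ ⊗₁ id) ≈ α⇒ ∘ α⇒
    hexagon  : ∀ {A B C} →
               α⇒ {B} {C} {A} ∘ σ {A} {B ⊗₀ C} ∘ α⇒ ≈
               (id ⊗₁ σ {A} {C}) ∘ α⇒ ∘ (σ {A} {B} ⊗₁ id)

  interchange : ∀ {A B C D} → ((A ⊗₀ B) ⊗₀ (C ⊗₀ D)) ⇒ ((A ⊗₀ C) ⊗₀ (B ⊗₀ D))
  interchange = α⇐ ∘ (id ⊗₁ (α⇒ ∘ (σ ⊗₁ id) ∘ α⇐)) ∘ α⇒

  field
    Δ : ∀ {X} → X ⇒ (X ⊗₀ X)
    ε : ∀ {X} → X ⇒ I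

    Δ-counitˡ : ∀ {X} → (ε ⊗₁ id) ∘ Δ {X} ≈ λ⇐
    Δ-counitʳ : ∀ {X} → (id ⊗₁ ε) ∘ Δ {X} ≈ ρ⇐
    Δ-coassoc : ∀ {X} → α⇒ ∘ (Δ ⊗₁ id) ∘ Δ {X} ≈ (id ⊗₁ Δ) ∘ Δ
    Δ-comm    : ∀ {X} → σ ∘ Δ {X} ≈ Δ

    Δ-⊗ : ∀ {X Y} → Δ {X ⊗₀ Y} ≈ interchange ∘ (Δ {X} ⊗₁ Δ {Y})
    ε-⊗ : ∀ {X Y} → ε {X ⊗₀ Y} ≈ λ⇒ ∘ (ε {X} ⊗₁ ε {Y})
    Δ-I : Δ {I} ≈ λ⇐
    ε-I : ε {I} ≈ id

module _ {o ℓ e} (𝒞 : CDCategory o ℓ e) where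
  open CDCategory 𝒞

  PartialChannel : ∀ {X Y} → X ⇒ Y → Set e
  PartialChannel f = f ≈ ρ⇒ ∘ (f ⊗₁ (ε ∘ f)) ∘ Δ

  record Normalisation : Set (o ⊔ ℓ ⊔ e) where
    field
      norm : ∀ {X Y} → X ⇒ Y → X ⇒ Y
      norm-resp-≈ : ∀ {X Y} {f g : X ⇒ Y} → f ≈ g → norm f ≈ norm g
      norm-partial : ∀ {X Y} (f : X ⇒ Y) → PartialChannel (norm f)
      N0 : ∀ {X Y} (f : X ⇒ Y) → f ≈ ρ⇒ ∘ (norm f ⊗₁ (ε ∘ f)) ∘ Δ
      N1 : ∀ {X Y} (f : X ⇒ Y) → PartialChannel f → norm f ≈ f
      N2 : ∀ {X Y Z W} (f : X ⇒ Y) (g : Z ⇒ W) → norm (f ⊗₁ g) ≈ norm f ⊗₁ norm g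
      N3 : ∀ {X Y} (f : X ⇒ Y) → norm (ε ∘ f) ≈ ε ∘ norm f
      N4 : ∀ {X Y} (f : (X ⊗₀ X) ⇒ Y) → norm (f ∘ Δ) ≈ norm f ∘ Δ

  record Caps : Set (o ⊔ ℓ ⊔ e) where
    field
      cap : ∀ {X} → (X ⊗₀ X) ⇒ I
      cap-σ : ∀ {X} → cap {X} ∘ σ ≈ cap
      cap-Δ : ∀ {X} → cap {X} ∘ Δ ≈ ε
      cap-Δ-swap : ∀ {X} →
        λ⇒ ∘ (cap {X} ⊗₁ id) ∘ α⇐ ∘ (id ⊗₁ Δ) ≈ ρ⇒ ∘ (id ⊗₁ cap {X}) ∘ α⇒ ∘ (Δ ⊗₁ id)
      cap-⊗ : ∀ {X Y} → cap {X ⊗₀ Y} ≈ λ⇒ ∘ (cap {X} ⊗₁ cap {Y}) ∘ interchange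
      cap-I : cap {I} ≈ λ⇒

    capApply : ∀ {A B X} → A ⇒ (B ⊗₀ X) → (A ⊗₀ X) ⇒ B
    capApply f = ρ⇒ ∘ (id ⊗₁ cap) ∘ α⇒ ∘ (f ⊗₁ id)

    Cancellative : Set (o ⊔ ℓ ⊔ e)
    Cancellative = ∀ {A B X} (f g : A ⇒ (B ⊗₀ X)) → capApply f ≈ capApply g → f ≈ g

  record EffectConditioning : Set (o ⊔ ℓ ⊔ e) where
    field
      normalisation : Normalisation
      caps : Caps
    open Normalisation normalisation public
    open Caps caps public
    field
      cancellative : Cancellative

module _ {o ℓ e} (𝒞 : CDCategory o ℓ e) (ec : EffectConditioning 𝒞) where
  open CDCategory 𝒞
  open EffectConditioning ec

  -- conditional of a state s : I → Y ⊗ Z, as a morphism Z → Y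
  -- (the conditional s|_Z : I ⊗ Z → Y precomposed with Z ≅ I ⊗ Z)
  stateConditional : ∀ {Y Z} → I ⇒ (Y ⊗₀ Z) → Z ⇒ Y
  stateConditional s = norm (capApply s) ∘ λ⇐

  ⨂ : List Obj → Obj
  ⨂ [] = I
  ⨂ (x ∷ xs) = x ⊗₀ ⨂ xs

  select : ∀ {m} → Subset m → Vec Obj m → List Obj
  select [] [] = []
  select (true ∷ S) (x ∷ xs) = x ∷ select S xs
  select (false ∷ S) (x ∷ xs) = select S xs

  Xₛ : ∀ {m} → Vec Obj m → Subset m → Obj
  Xₛ Xs S = ⨂ (select S Xs)

  Xall : ∀ {m} → Vec Obj m → Obj
  Xall Xs = ⨂ (toList Xs)

  marg : ∀ {m} (S : Subset m) (Xs : Vec Obj m) → Xall Xs ⇒ Xₛ Xs S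
  marg [] [] = id
  marg (true ∷ S) (x ∷ xs) = id ⊗₁ marg S xs
  marg (false ∷ S) (x ∷ xs) = λ⇒ ∘ (ε ⊗₁ marg S xs)

  -- the symmetry isomorphism X_{S ∪ T} ≅ X_S ⊗ X_T (for disjoint S, T;
  -- a factor lying in both S and T, which never happens for disjoint sets,
  -- is copied)
  split : ∀ {m} (S T : Subset m) (Xs : Vec Obj m) →
          Xₛ Xs (S ∪ T) ⇒ (Xₛ Xs S ⊗₀ Xₛ Xs T)
  split [] [] [] = λ⇐
  split (true ∷ S) (true ∷ T) (x ∷ xs) = interchange ∘ (Δ ⊗₁ split S T xs)
  split (true ∷ S) (false ∷ T) (x ∷ xs) = α⇐ ∘ (id ⊗₁ split S T xs)
  split (false ∷ S) (true ∷ T) (x ∷ xs) = α⇒ ∘ (σ ⊗₁ id) ∘ α⇐ ∘ (id ⊗₁ split S T xs)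
  split (false ∷ S) (false ∷ T) (x ∷ xs) = split S T xs

  module _ {n : ℕ} (Xs : Vec Obj n) (ω : I ⇒ Xall Xs) where

    marginal : (S : Subset n) → I ⇒ Xₛ Xs S
    marginal S = marg S Xs ∘ ω

    jointState : (S T : Subset n) → I ⇒ (Xₛ Xs S ⊗₀ Xₛ Xs T)
    jointState S T = split S T Xs ∘ marginal (S ∪ T)

    condOf : (S T : Subset n) → Xₛ Xs T ⇒ Xₛ Xs S
    condOf S T = stateConditional (jointState S T)

    CondIndep : (A B C : Subset n) → Set e
    CondIndep A B C =
      split A B Xs ∘ condOf (A ∪ B) C ≈ (condOf A C ⊗₁ condOf B C) ∘ Δ

Disjoint : ∀ {n} → Subset n → Subset n → Set
Disjoint S T = Empty (S ∩ T)

{-# OPTIONS --safe #-}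
-- Write x, z for the marginal projections out of X_1 ⊗ ... ⊗ X_n; they are total and
-- deterministic, and ω_{S|T} is the conditional of the state ⟨x, z⟩ ∘ ω. Effect conditioning
-- makes these conditionals behave like probabilistic ones: every such state disintegrates as
-- ⟨k ∘ z, z⟩ ∘ ω with k the conditional (cancellativity of caps plus N0), and the conditional is
-- the unique partial channel with the right support doing so (N1–N4). Consequently
-- x ⊥⊥ y ∣ z holds iff ⟨⟨x, y⟩, z⟩ ∘ ω = ⟨⟨k ∘ z, y⟩, z⟩ ∘ ω for some k. Symmetry and
-- decomposition hold because conditionals commute with total post-processing; weak union and
-- contraction are regroupings of such factorisations, using that the marginal on C ∪ D and the
-- pair of the marginals on C and D determine each other when C and D are disjoint.
module Submission where

open import Defs
open import Data.Bool using (true; false)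
open import Data.Empty using (⊥; ⊥-elim)
open import Data.Fin using (zero; suc)
open import Data.Fin.Subset using (Subset; _∪_)
open import Data.Nat using (ℕ)
open import Data.Product using (_×_; _,_; map)
open import Data.Vec using (Vec; []; _∷_; here; there)
open import Function.Bundles using (_⇔_; mk⇔)
open import Relation.Binary.Bundles using (Setoid)
import Relation.Binary.Reasoning.Setoid as SetoidReasoning

module CDProperties {o ℓ e} (𝒞 : CDCategory o ℓ e) where
  open CDCategory 𝒞

  hom-setoid : ∀ {A B} → Setoid ℓ e
  hom-setoid {A} {B} = record { Carrier = A ⇒ B ; _≈_ = _≈_ ; isEquivalence = ≈-equiv }

  module HomReasoning {A B : Obj} = SetoidReasoning (hom-setoid {A} {B})
  open HomReasoning public
  open module HomEquivalence {A B : Obj} = Setoid (hom-setoid {A} {B}) public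
    using (refl; sym; trans)

  ∘ˡ : ∀ {A B C} {f f′ : B ⇒ C} {g : A ⇒ B} → f ≈ f′ → f ∘ g ≈ f′ ∘ g
  ∘ˡ p = ∘-resp-≈ p refl
  ∘ʳ : ∀ {A B C} {f : B ⇒ C} {g g′ : A ⇒ B} → g ≈ g′ → f ∘ g ≈ f ∘ g′
  ∘ʳ p = ∘-resp-≈ refl p
  ⊗ˡ : ∀ {A B C D} {f f′ : A ⇒ B} {g : C ⇒ D} → f ≈ f′ → f ⊗₁ g ≈ f′ ⊗₁ g
  ⊗ˡ p = ⊗-resp-≈ p refl
  ⊗ʳ : ∀ {A B C D} {f : A ⇒ B} {g g′ : C ⇒ D} → g ≈ g′ → f ⊗₁ g ≈ f ⊗₁ g′
  ⊗ʳ p = ⊗-resp-≈ refl p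

  sym-assoc : ∀ {A B C D} {f : A ⇒ B} {g : B ⇒ C} {h : C ⇒ D} →
              h ∘ (g ∘ f) ≈ (h ∘ g) ∘ f
  sym-assoc = sym assoc

  extendʳ : ∀ {A B C D E} {b : C ⇒ D} {c : B ⇒ C} {x : E ⇒ D} {y : B ⇒ E} {d : A ⇒ B} →
            b ∘ c ≈ x ∘ y → b ∘ (c ∘ d) ≈ x ∘ (y ∘ d)
  extendʳ p = trans sym-assoc (trans (∘ˡ p) assoc)

  pullˡ : ∀ {A B C D} {b : C ⇒ D} {c : B ⇒ C} {x : B ⇒ D} {d : A ⇒ B} →
          b ∘ c ≈ x → b ∘ (c ∘ d) ≈ x ∘ d
  pullˡ p = trans sym-assoc (∘ˡ p)

  cancelˡ : ∀ {A B C} {i : B ⇒ C} {j : C ⇒ B} {d : A ⇒ C} → i ∘ j ≈ id → i ∘ (j ∘ d) ≈ d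
  cancelˡ p = trans (pullˡ p) identityˡ

  cancelʳ : ∀ {A B C} {i : B ⇒ A} {j : A ⇒ B} {d : A ⇒ C} → i ∘ j ≈ id → (d ∘ i) ∘ j ≈ d
  cancelʳ p = trans assoc (trans (∘ʳ p) identityʳ)

  ∘-⊗ : ∀ {A B C D E F} {f : B ⇒ C} {g : A ⇒ B} {h : E ⇒ F} {k : D ⇒ E} →
        (f ⊗₁ h) ∘ (g ⊗₁ k) ≈ (f ∘ g) ⊗₁ (h ∘ k)
  ∘-⊗ = sym ⊗-∘

  id⊗∘ : ∀ {X A B C} {f : B ⇒ C} {g : A ⇒ B} →
         (id {X} ⊗₁ f) ∘ (id ⊗₁ g) ≈ id ⊗₁ (f ∘ g)
  id⊗∘ = trans ∘-⊗ (⊗ˡ identityˡ)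

  id⊗id∘ : ∀ {A X Y} {h : A ⇒ X ⊗₀ Y} → (id ⊗₁ id) ∘ h ≈ h
  id⊗id∘ = trans (∘ˡ ⊗-id) identityˡ

  ∘⊗id : ∀ {X A B C} {f : B ⇒ C} {g : A ⇒ B} →
         (f ⊗₁ id {X}) ∘ (g ⊗₁ id) ≈ (f ∘ g) ⊗₁ id
  ∘⊗id = trans ∘-⊗ (⊗ʳ identityˡ)

  ⊗≈⊗id∘id⊗ : ∀ {A B C D} {f : A ⇒ B} {g : C ⇒ D} → f ⊗₁ g ≈ (f ⊗₁ id) ∘ (id ⊗₁ g)
  ⊗≈⊗id∘id⊗ = trans (⊗-resp-≈ (sym identityʳ) (sym identityˡ)) ⊗-∘

  ⊗≈id⊗∘⊗id : ∀ {A B C D} {f : A ⇒ B} {g : C ⇒ D} → f ⊗₁ g ≈ (id ⊗₁ g) ∘ (f ⊗₁ id)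
  ⊗≈id⊗∘⊗id = trans (⊗-resp-≈ (sym identityˡ) (sym identityʳ)) ⊗-∘

  ⊗id∘id⊗≈id⊗∘⊗id : ∀ {A B C D} {f : A ⇒ B} {g : C ⇒ D} → (f ⊗₁ id) ∘ (id ⊗₁ g) ≈ (id ⊗₁ g) ∘ (f ⊗₁ id)
  ⊗id∘id⊗≈id⊗∘⊗id = trans (sym ⊗≈⊗id∘id⊗) ⊗≈id⊗∘⊗id

  flip-square : ∀ {A B C D} {i : A ⇒ B} {i′ : B ⇒ A} {F : C ⇒ A} {G : D ⇒ B} {j : C ⇒ D} {j′ : D ⇒ C} →
                i′ ∘ i ≈ id → j ∘ j′ ≈ id → i ∘ F ≈ G ∘ j → i′ ∘ G ≈ F ∘ j′
  flip-square {i = i} {i′} {F} {G} {j} {j′} ii jj sq = begin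
    i′ ∘ G               ≈⟨ ∘ʳ identityʳ ⟨
    i′ ∘ (G ∘ id)        ≈⟨ ∘ʳ (∘ʳ jj) ⟨
    i′ ∘ (G ∘ (j ∘ j′))  ≈⟨ ∘ʳ sym-assoc ⟩
    i′ ∘ ((G ∘ j) ∘ j′)  ≈⟨ ∘ʳ (∘ˡ sq) ⟨
    i′ ∘ ((i ∘ F) ∘ j′)  ≈⟨ ∘ʳ assoc ⟩
    i′ ∘ (i ∘ (F ∘ j′))  ≈⟨ cancelˡ ii ⟩
    F ∘ j′ ∎

  α⇐-natural : ∀ {A A′ B B′ C C′} {f : A ⇒ A′} {g : B ⇒ B′} {h : C ⇒ C′} →
               α⇐ ∘ (f ⊗₁ (g ⊗₁ h)) ≈ ((f ⊗₁ g) ⊗₁ h) ∘ α⇐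
  α⇐-natural = flip-square α-isoˡ α-isoʳ α-natural

  λ⇐-natural : ∀ {A B} {f : A ⇒ B} → λ⇐ ∘ f ≈ (id ⊗₁ f) ∘ λ⇐
  λ⇐-natural = flip-square λ-isoˡ λ-isoʳ λ-natural

  ρ⇐-natural : ∀ {A B} {f : A ⇒ B} → ρ⇐ ∘ f ≈ (f ⊗₁ id) ∘ ρ⇐
  ρ⇐-natural = flip-square ρ-isoˡ ρ-isoʳ ρ-natural

  iso-cancelʳ : ∀ {A B C} {u : A ⇒ B} {v : B ⇒ A} {X Y : B ⇒ C} →
                u ∘ v ≈ id → X ∘ u ≈ Y ∘ u → X ≈ Y
  iso-cancelʳ {u = u} {v} {X} {Y} uv p = begin
    X            ≈⟨ identityʳ ⟨
    X ∘ id       ≈⟨ ∘ʳ uv ⟨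
    X ∘ (u ∘ v)  ≈⟨ sym-assoc ⟩
    (X ∘ u) ∘ v  ≈⟨ ∘ˡ p ⟩
    (Y ∘ u) ∘ v  ≈⟨ assoc ⟩
    Y ∘ (u ∘ v)  ≈⟨ ∘ʳ uv ⟩
    Y ∘ id       ≈⟨ identityʳ ⟩
    Y ∎

  ⊗id-iso : ∀ {A B C} {u : A ⇒ B} {v : B ⇒ A} → u ∘ v ≈ id → (u ⊗₁ id {C}) ∘ (v ⊗₁ id) ≈ id
  ⊗id-iso p = trans ∘⊗id (trans (⊗ˡ p) ⊗-id)

  id⊗-iso : ∀ {A B C} {u : A ⇒ B} {v : B ⇒ A} → u ∘ v ≈ id → (id {C} ⊗₁ u) ∘ (id ⊗₁ v) ≈ id
  id⊗-iso p = trans id⊗∘ (trans (⊗ʳ p) ⊗-id)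

  -- In a cd-category this is the counit law at I, as Δ_I = λ⇐ and ε_I = id.
  λ⇐≈ρ⇐ : λ⇐ {I} ≈ ρ⇐ {I}
  λ⇐≈ρ⇐ = begin
    λ⇐               ≈⟨ identityˡ ⟨
    id ∘ λ⇐          ≈⟨ ∘ˡ ⊗-id ⟨
    (id ⊗₁ id) ∘ λ⇐  ≈⟨ ∘-resp-≈ (⊗ʳ ε-I) Δ-I ⟨
    (id ⊗₁ ε) ∘ Δ    ≈⟨ Δ-counitʳ ⟩
    ρ⇐ ∎

  λ⇒≈ρ⇒ : λ⇒ {I} ≈ ρ⇒ {I}
  λ⇒≈ρ⇒ = begin
    λ⇒              ≈⟨ identityʳ ⟨
    λ⇒ ∘ id         ≈⟨ ∘ʳ ρ-isoˡ ⟨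
    λ⇒ ∘ (ρ⇐ ∘ ρ⇒)  ≈⟨ ∘ʳ (∘ˡ λ⇐≈ρ⇐) ⟨
    λ⇒ ∘ (λ⇐ ∘ ρ⇒)  ≈⟨ cancelˡ λ-isoʳ ⟩
    ρ⇒ ∎

  σ∘λ⇐≈ρ⇐ : ∀ {Z} → σ ∘ λ⇐ {Z} ≈ ρ⇐
  σ∘λ⇐≈ρ⇐ = begin
    σ ∘ λ⇐               ≈⟨ ∘ʳ Δ-counitˡ ⟨
    σ ∘ ((ε ⊗₁ id) ∘ Δ)  ≈⟨ extendʳ σ-natural ⟩
    (id ⊗₁ ε) ∘ (σ ∘ Δ)  ≈⟨ ∘ʳ Δ-comm ⟩
    (id ⊗₁ ε) ∘ Δ        ≈⟨ Δ-counitʳ ⟩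
    ρ⇐ ∎

  ρ⇒∘σ≈λ⇒ : ∀ {Z} → ρ⇒ ∘ σ ≈ λ⇒ {Z}
  ρ⇒∘σ≈λ⇒ = begin
    ρ⇒ ∘ σ                ≈⟨ identityʳ ⟨
    (ρ⇒ ∘ σ) ∘ id         ≈⟨ ∘ʳ λ-isoˡ ⟨
    (ρ⇒ ∘ σ) ∘ (λ⇐ ∘ λ⇒)  ≈⟨ assoc ⟩
    ρ⇒ ∘ (σ ∘ (λ⇐ ∘ λ⇒))  ≈⟨ ∘ʳ (pullˡ σ∘λ⇐≈ρ⇐) ⟩
    ρ⇒ ∘ (ρ⇐ ∘ λ⇒)        ≈⟨ cancelˡ ρ-isoʳ ⟩
    λ⇒ ∎

  triangle⇐ : ∀ {A B} → α⇒ ∘ (ρ⇐ ⊗₁ id) ≈ id {A} ⊗₁ λ⇐ {B}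
  triangle⇐ = begin
    α⇒ ∘ (ρ⇐ ⊗₁ id)                                ≈⟨ cancelˡ (id⊗-iso λ-isoˡ) ⟨
    (id ⊗₁ λ⇐) ∘ ((id ⊗₁ λ⇒) ∘ (α⇒ ∘ (ρ⇐ ⊗₁ id)))  ≈⟨ ∘ʳ (pullˡ triangle) ⟩
    (id ⊗₁ λ⇐) ∘ ((ρ⇒ ⊗₁ id) ∘ (ρ⇐ ⊗₁ id))         ≈⟨ ∘ʳ (⊗id-iso ρ-isoʳ) ⟩
    (id ⊗₁ λ⇐) ∘ id                                ≈⟨ identityʳ ⟩
    id ⊗₁ λ⇐ ∎

  I⊗-faithful : ∀ {A B} {f g : A ⇒ B} → id {I} ⊗₁ f ≈ id ⊗₁ g → f ≈ g
  I⊗-faithful {f = f} {g} p = begin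
    f                      ≈⟨ cancelˡ λ-isoʳ ⟨
    λ⇒ ∘ (λ⇐ ∘ f)          ≈⟨ ∘ʳ λ⇐-natural ⟩
    λ⇒ ∘ ((id ⊗₁ f) ∘ λ⇐)  ≈⟨ ∘ʳ (∘ˡ p) ⟩
    λ⇒ ∘ ((id ⊗₁ g) ∘ λ⇐)  ≈⟨ ∘ʳ λ⇐-natural ⟨
    λ⇒ ∘ (λ⇐ ∘ g)          ≈⟨ cancelˡ λ-isoʳ ⟩
    g ∎

  -- Kelly's argument: after whiskering with I and precomposing with the isomorphism u,
  -- both sides agree by the pentagon and triangle axioms.
  λ⇒∘α⇒≈λ⇒⊗id : ∀ {A B} → λ⇒ {A ⊗₀ B} ∘ α⇒ ≈ λ⇒ ⊗₁ id
  λ⇒∘α⇒≈λ⇒⊗id {A} {B} = I⊗-faithful (iso-cancelʳ uv whiskered)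
    where
    u : ((I ⊗₀ I) ⊗₀ A) ⊗₀ B ⇒ I ⊗₀ ((I ⊗₀ A) ⊗₀ B)
    u = α⇒ ∘ (α⇒ ⊗₁ id)
    v : I ⊗₀ ((I ⊗₀ A) ⊗₀ B) ⇒ ((I ⊗₀ I) ⊗₀ A) ⊗₀ B
    v = (α⇐ ⊗₁ id) ∘ α⇐
    uv : u ∘ v ≈ id
    uv = trans assoc (trans (∘ʳ (cancelˡ (⊗id-iso α-isoʳ))) α-isoʳ)
    whiskered : (id ⊗₁ (λ⇒ ∘ α⇒)) ∘ u ≈ (id ⊗₁ (λ⇒ ⊗₁ id)) ∘ u
    whiskered = begin
      (id ⊗₁ (λ⇒ ∘ α⇒)) ∘ (α⇒ ∘ (α⇒ ⊗₁ id))          ≈⟨ ∘ˡ id⊗∘ ⟨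
      ((id ⊗₁ λ⇒) ∘ (id ⊗₁ α⇒)) ∘ (α⇒ ∘ (α⇒ ⊗₁ id))  ≈⟨ assoc ⟩
      (id ⊗₁ λ⇒) ∘ ((id ⊗₁ α⇒) ∘ (α⇒ ∘ (α⇒ ⊗₁ id)))  ≈⟨ ∘ʳ pentagon ⟩
      (id ⊗₁ λ⇒) ∘ (α⇒ ∘ α⇒)                         ≈⟨ pullˡ triangle ⟩
      (ρ⇒ ⊗₁ id) ∘ α⇒                                ≈⟨ ∘ˡ (⊗ʳ ⊗-id) ⟨
      (ρ⇒ ⊗₁ (id ⊗₁ id)) ∘ α⇒                        ≈⟨ α-natural ⟨
      α⇒ ∘ ((ρ⇒ ⊗₁ id) ⊗₁ id)                        ≈⟨ ∘ʳ (⊗ˡ triangle) ⟨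
      α⇒ ∘ (((id ⊗₁ λ⇒) ∘ α⇒) ⊗₁ id)                 ≈⟨ ∘ʳ ∘⊗id ⟨
      α⇒ ∘ (((id ⊗₁ λ⇒) ⊗₁ id) ∘ (α⇒ ⊗₁ id))         ≈⟨ extendʳ α-natural ⟩
      (id ⊗₁ (λ⇒ ⊗₁ id)) ∘ (α⇒ ∘ (α⇒ ⊗₁ id)) ∎

  λ⇒⊗id∘α⇐≈λ⇒ : ∀ {A B} → (λ⇒ ⊗₁ id) ∘ α⇐ ≈ λ⇒ {A ⊗₀ B}
  λ⇒⊗id∘α⇐≈λ⇒ = trans (∘ˡ (sym λ⇒∘α⇒≈λ⇒⊗id)) (cancelʳ α-isoʳ)

  α⇐∘λ⇐≈λ⇐⊗id : ∀ {A B} → α⇐ ∘ λ⇐ ≈ λ⇐ {A} ⊗₁ id {B}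
  α⇐∘λ⇐≈λ⇐⊗id = begin
    α⇐ ∘ λ⇐                                ≈⟨ cancelˡ (⊗id-iso λ-isoˡ) ⟨
    (λ⇐ ⊗₁ id) ∘ ((λ⇒ ⊗₁ id) ∘ (α⇐ ∘ λ⇐))  ≈⟨ ∘ʳ (pullˡ λ⇒⊗id∘α⇐≈λ⇒) ⟩
    (λ⇐ ⊗₁ id) ∘ (λ⇒ ∘ λ⇐)                 ≈⟨ ∘ʳ λ-isoʳ ⟩
    (λ⇐ ⊗₁ id) ∘ id                        ≈⟨ identityʳ ⟩
    λ⇐ ⊗₁ id ∎

  α⇒∘λ⇐⊗id≈λ⇐ : ∀ {A B} → α⇒ ∘ (λ⇐ ⊗₁ id) ≈ λ⇐ {A ⊗₀ B}
  α⇒∘λ⇐⊗id≈λ⇐ = trans (∘ʳ (sym α⇐∘λ⇐≈λ⇐⊗id)) (cancelˡ α-isoʳ)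

  ⊗-square : ∀ {A B C D E F G H} {f : B ⇒ C} {a : A ⇒ B} {b : D ⇒ C} {g : A ⇒ D}
             {h : F ⇒ G} {c : E ⇒ F} {d : H ⇒ G} {k : E ⇒ H} →
             f ∘ a ≈ b ∘ g → h ∘ c ≈ d ∘ k → (f ⊗₁ h) ∘ (a ⊗₁ c) ≈ (b ⊗₁ d) ∘ (g ⊗₁ k)
  ⊗-square p q = trans ∘-⊗ (trans (⊗-resp-≈ p q) ⊗-∘)

  id-comm : ∀ {A B} {f : A ⇒ B} → id ∘ f ≈ f ∘ id
  id-comm = trans identityˡ (sym identityʳ)

  swapˡ : ∀ {X Y Z} → X ⊗₀ (Y ⊗₀ Z) ⇒ Y ⊗₀ (X ⊗₀ Z)
  swapˡ = α⇒ ∘ ((σ ⊗₁ id) ∘ α⇐)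

  swapˡ-natural : ∀ {X X′ Y Y′ Z Z′} {g : X ⇒ X′} {h : Y ⇒ Y′} {k : Z ⇒ Z′} →
                  swapˡ ∘ (g ⊗₁ (h ⊗₁ k)) ≈ (h ⊗₁ (g ⊗₁ k)) ∘ swapˡ
  swapˡ-natural = begin
    (α⇒ ∘ ((σ ⊗₁ id) ∘ α⇐)) ∘ _       ≈⟨ assoc ⟩
    α⇒ ∘ ((σ ⊗₁ id) ∘ α⇐) ∘ _         ≈⟨ ∘ʳ assoc ⟩
    α⇒ ∘ (σ ⊗₁ id) ∘ (α⇐ ∘ _)         ≈⟨ ∘ʳ (∘ʳ α⇐-natural) ⟩
    α⇒ ∘ (σ ⊗₁ id) ∘ (_ ∘ α⇐)         ≈⟨ ∘ʳ (extendʳ (⊗-square σ-natural id-comm)) ⟩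
    α⇒ ∘ (_ ⊗₁ _) ∘ ((σ ⊗₁ id) ∘ α⇐)  ≈⟨ extendʳ α-natural ⟩
    _ ∘ swapˡ ∎

  interchange-natural : ∀ {A A′ B B′ C C′ D D′} {f : A ⇒ A′} {g : B ⇒ B′} {h : C ⇒ C′} {k : D ⇒ D′} →
                        interchange ∘ ((f ⊗₁ g) ⊗₁ (h ⊗₁ k)) ≈ ((f ⊗₁ h) ⊗₁ (g ⊗₁ k)) ∘ interchange
  interchange-natural = begin
    (α⇐ ∘ (id ⊗₁ swapˡ) ∘ α⇒) ∘ _                       ≈⟨ assoc ⟩
    α⇐ ∘ ((id ⊗₁ swapˡ) ∘ α⇒) ∘ _                       ≈⟨ ∘ʳ assoc ⟩
    α⇐ ∘ (id ⊗₁ swapˡ) ∘ (α⇒ ∘ _)                       ≈⟨ ∘ʳ (∘ʳ α-natural) ⟩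
    α⇐ ∘ (id ⊗₁ swapˡ) ∘ (_ ∘ α⇒)                       ≈⟨ ∘ʳ (extendʳ (⊗-square id-comm swapˡ-natural)) ⟩
    α⇐ ∘ (_ ⊗₁ (_ ⊗₁ (_ ⊗₁ _))) ∘ ((id ⊗₁ swapˡ) ∘ α⇒)  ≈⟨ extendʳ α⇐-natural ⟩
    _ ∘ interchange ∎

  swapˡ∘λ⇐≈id⊗λ⇐ : ∀ {Y Z} → swapˡ ∘ λ⇐ {Y ⊗₀ Z} ≈ id ⊗₁ λ⇐
  swapˡ∘λ⇐≈id⊗λ⇐ = begin
    (α⇒ ∘ ((σ ⊗₁ id) ∘ α⇐)) ∘ λ⇐  ≈⟨ assoc ⟩
    α⇒ ∘ ((σ ⊗₁ id) ∘ α⇐) ∘ λ⇐    ≈⟨ ∘ʳ assoc ⟩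
    α⇒ ∘ (σ ⊗₁ id) ∘ (α⇐ ∘ λ⇐)    ≈⟨ ∘ʳ (∘ʳ α⇐∘λ⇐≈λ⇐⊗id) ⟩
    α⇒ ∘ (σ ⊗₁ id) ∘ (λ⇐ ⊗₁ id)   ≈⟨ ∘ʳ ∘⊗id ⟩
    α⇒ ∘ ((σ ∘ λ⇐) ⊗₁ id)         ≈⟨ ∘ʳ (⊗ˡ σ∘λ⇐≈ρ⇐) ⟩
    α⇒ ∘ (ρ⇐ ⊗₁ id)               ≈⟨ triangle⇐ ⟩
    id ⊗₁ λ⇐ ∎

  interchange∘λ⇐⊗id : ∀ {X Y Z} → interchange ∘ (λ⇐ {X} ⊗₁ id {Y ⊗₀ Z}) ≈ (λ⇐ ⊗₁ id) ∘ swapˡ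
  interchange∘λ⇐⊗id = begin
    (α⇐ ∘ (id ⊗₁ swapˡ) ∘ α⇒) ∘ (λ⇐ ⊗₁ id)  ≈⟨ assoc ⟩
    α⇐ ∘ ((id ⊗₁ swapˡ) ∘ α⇒) ∘ (λ⇐ ⊗₁ id)  ≈⟨ ∘ʳ assoc ⟩
    α⇐ ∘ (id ⊗₁ swapˡ) ∘ (α⇒ ∘ (λ⇐ ⊗₁ id))  ≈⟨ ∘ʳ (∘ʳ α⇒∘λ⇐⊗id≈λ⇐) ⟩
    α⇐ ∘ (id ⊗₁ swapˡ) ∘ λ⇐                 ≈⟨ ∘ʳ λ⇐-natural ⟨
    α⇐ ∘ λ⇐ ∘ swapˡ                         ≈⟨ pullˡ α⇐∘λ⇐≈λ⇐⊗id ⟩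
    (λ⇐ ⊗₁ id) ∘ swapˡ ∎

  interchange∘ρ⇐⊗id : ∀ {X Y Z} → interchange ∘ (ρ⇐ {X} ⊗₁ id {Y ⊗₀ Z}) ≈ α⇐ ∘ (id ⊗₁ (id ⊗₁ λ⇐))
  interchange∘ρ⇐⊗id = begin
    (α⇐ ∘ (id ⊗₁ swapˡ) ∘ α⇒) ∘ (ρ⇐ ⊗₁ id)  ≈⟨ assoc ⟩
    α⇐ ∘ ((id ⊗₁ swapˡ) ∘ α⇒) ∘ (ρ⇐ ⊗₁ id)  ≈⟨ ∘ʳ assoc ⟩
    α⇐ ∘ (id ⊗₁ swapˡ) ∘ (α⇒ ∘ (ρ⇐ ⊗₁ id))  ≈⟨ ∘ʳ (∘ʳ triangle⇐) ⟩
    α⇐ ∘ (id ⊗₁ swapˡ) ∘ (id ⊗₁ λ⇐)         ≈⟨ ∘ʳ id⊗∘ ⟩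
    α⇐ ∘ (id ⊗₁ (swapˡ ∘ λ⇐))               ≈⟨ ∘ʳ (⊗ʳ swapˡ∘λ⇐≈id⊗λ⇐) ⟩
    α⇐ ∘ (id ⊗₁ (id ⊗₁ λ⇐)) ∎

  λ⇒⊗λ⇒∘interchange∘Δ⊗id≈λ⇒ : ∀ {Y Z} → (λ⇒ ⊗₁ λ⇒) ∘ interchange ∘ (Δ {I} ⊗₁ id {Y ⊗₀ Z}) ≈ λ⇒
  λ⇒⊗λ⇒∘interchange∘Δ⊗id≈λ⇒ = begin
    (λ⇒ ⊗₁ λ⇒) ∘ interchange ∘ (Δ ⊗₁ id)   ≈⟨ ∘ʳ (∘ʳ (⊗ˡ Δ-I)) ⟩
    (λ⇒ ⊗₁ λ⇒) ∘ interchange ∘ (λ⇐ ⊗₁ id)  ≈⟨ ∘ʳ interchange∘λ⇐⊗id ⟩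
    (λ⇒ ⊗₁ λ⇒) ∘ (λ⇐ ⊗₁ id) ∘ swapˡ        ≈⟨ pullˡ ∘-⊗ ⟩
    ((λ⇒ ∘ λ⇐) ⊗₁ (λ⇒ ∘ id)) ∘ swapˡ       ≈⟨ ∘ˡ (⊗-resp-≈ λ-isoʳ identityʳ) ⟩
    (id ⊗₁ λ⇒) ∘ α⇒ ∘ ((σ ⊗₁ id) ∘ α⇐)     ≈⟨ pullˡ triangle ⟩
    (ρ⇒ ⊗₁ id) ∘ ((σ ⊗₁ id) ∘ α⇐)          ≈⟨ pullˡ ∘⊗id ⟩
    ((ρ⇒ ∘ σ) ⊗₁ id) ∘ α⇐                  ≈⟨ ∘ˡ (⊗ˡ ρ⇒∘σ≈λ⇒) ⟩
    (λ⇒ ⊗₁ id) ∘ α⇐                        ≈⟨ λ⇒⊗id∘α⇐≈λ⇒ ⟩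
    λ⇒ ∎

  ε⊗ε∘Δ≈Δ∘ε : ∀ {X} → (ε ⊗₁ ε) ∘ Δ {X} ≈ Δ ∘ ε
  ε⊗ε∘Δ≈Δ∘ε = begin
    (ε ⊗₁ ε) ∘ Δ                 ≈⟨ ∘ˡ ⊗≈⊗id∘id⊗ ⟩
    ((ε ⊗₁ id) ∘ (id ⊗₁ ε)) ∘ Δ  ≈⟨ assoc ⟩
    (ε ⊗₁ id) ∘ ((id ⊗₁ ε) ∘ Δ)  ≈⟨ ∘ʳ Δ-counitʳ ⟩
    (ε ⊗₁ id) ∘ ρ⇐               ≈⟨ ρ⇐-natural ⟨
    ρ⇐ ∘ ε                       ≈⟨ ∘ˡ λ⇐≈ρ⇐ ⟨
    λ⇐ ∘ ε                       ≈⟨ ∘ˡ Δ-I ⟨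
    Δ ∘ ε ∎

  Total : ∀ {A B} → A ⇒ B → Set e
  Total f = ε ∘ f ≈ ε

  ε∘⊗ : ∀ {A B C D} {f : A ⇒ B} {g : C ⇒ D} → ε ∘ (f ⊗₁ g) ≈ λ⇒ ∘ ((ε ∘ f) ⊗₁ (ε ∘ g))
  ε∘⊗ = trans (∘ˡ ε-⊗) (trans assoc (∘ʳ ∘-⊗))

  Total-id : ∀ {A} → Total (id {A})
  Total-id = identityʳ

  Total-∘ : ∀ {A B C} {f : B ⇒ C} {g : A ⇒ B} → Total f → Total g → Total (f ∘ g)
  Total-∘ p q = trans sym-assoc (trans (∘ˡ p) q)

  Total-⊗ : ∀ {A B C D} {f : A ⇒ B} {g : C ⇒ D} → Total f → Total g → Total (f ⊗₁ g)
  Total-⊗ p q = trans ε∘⊗ (trans (∘ʳ (⊗-resp-≈ p q)) (sym ε-⊗))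

  Total-inverse : ∀ {A B} {f : A ⇒ B} {g : B ⇒ A} → Total f → f ∘ g ≈ id → Total g
  Total-inverse {f = f} {g} p fg = begin
    ε ∘ g        ≈⟨ ∘ˡ p ⟨
    (ε ∘ f) ∘ g  ≈⟨ assoc ⟩
    ε ∘ (f ∘ g)  ≈⟨ ∘ʳ fg ⟩
    ε ∘ id       ≈⟨ identityʳ ⟩
    ε ∎

  Total-λ⇒ : ∀ {A} → Total (λ⇒ {A})
  Total-λ⇒ = begin
    ε ∘ λ⇒          ≈⟨ λ-natural ⟨
    λ⇒ ∘ (id ⊗₁ ε)  ≈⟨ ∘ʳ (⊗ˡ ε-I) ⟨
    λ⇒ ∘ (ε ⊗₁ ε)   ≈⟨ ε-⊗ ⟨
    ε ∎

  Total-λ⇐ : ∀ {A} → Total (λ⇐ {A})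
  Total-λ⇐ = Total-inverse Total-λ⇒ λ-isoʳ

  Total-ρ⇒ : ∀ {A} → Total (ρ⇒ {A})
  Total-ρ⇒ = begin
    ε ∘ ρ⇒          ≈⟨ ρ-natural ⟨
    ρ⇒ ∘ (ε ⊗₁ id)  ≈⟨ ∘ʳ (⊗ʳ ε-I) ⟨
    ρ⇒ ∘ (ε ⊗₁ ε)   ≈⟨ ∘ˡ λ⇒≈ρ⇒ ⟨
    λ⇒ ∘ (ε ⊗₁ ε)   ≈⟨ ε-⊗ ⟨
    ε ∎

  Total-ε : ∀ {A} → Total (ε {A})
  Total-ε = trans (∘ˡ ε-I) identityˡ

  Total-Δ : ∀ {A} → Total (Δ {A})
  Total-Δ = begin
    ε ∘ Δ                ≈⟨ ∘ˡ ε-⊗ ⟩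
    (λ⇒ ∘ (ε ⊗₁ ε)) ∘ Δ  ≈⟨ assoc ⟩
    λ⇒ ∘ ((ε ⊗₁ ε) ∘ Δ)  ≈⟨ ∘ʳ ε⊗ε∘Δ≈Δ∘ε ⟩
    λ⇒ ∘ (Δ ∘ ε)         ≈⟨ ∘ʳ (∘ˡ Δ-I) ⟩
    λ⇒ ∘ (λ⇐ ∘ ε)        ≈⟨ cancelˡ λ-isoʳ ⟩
    ε ∎

  Total-σ : ∀ {A B} → Total (σ {A} {B})
  Total-σ = begin
    ε ∘ σ                ≈⟨ ∘ˡ ε-⊗ ⟩
    (λ⇒ ∘ (ε ⊗₁ ε)) ∘ σ  ≈⟨ assoc ⟩
    λ⇒ ∘ ((ε ⊗₁ ε) ∘ σ)  ≈⟨ ∘ʳ σ-natural ⟨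
    λ⇒ ∘ (σ ∘ (ε ⊗₁ ε))  ≈⟨ pullˡ (trans (∘ˡ λ⇒≈ρ⇒) ρ⇒∘σ≈λ⇒) ⟩
    λ⇒ ∘ (ε ⊗₁ ε)        ≈⟨ ε-⊗ ⟨
    ε ∎

  Total-α⇒ : ∀ {A B C} → Total (α⇒ {A} {B} {C})
  Total-α⇒ = begin
    ε ∘ α⇒                                      ≈⟨ ∘ˡ (trans ε-⊗ (∘ʳ (⊗ʳ ε-⊗))) ⟩
    (λ⇒ ∘ (ε ⊗₁ (λ⇒ ∘ (ε ⊗₁ ε)))) ∘ α⇒          ≈⟨ assoc ⟩
    λ⇒ ∘ ((ε ⊗₁ (λ⇒ ∘ (ε ⊗₁ ε))) ∘ α⇒)          ≈⟨ ∘ʳ (∘ˡ (trans (⊗ˡ (sym identityˡ)) ⊗-∘)) ⟩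
    λ⇒ ∘ (((id ⊗₁ λ⇒) ∘ (ε ⊗₁ (ε ⊗₁ ε))) ∘ α⇒)  ≈⟨ ∘ʳ assoc ⟩
    λ⇒ ∘ (id ⊗₁ λ⇒) ∘ ((ε ⊗₁ (ε ⊗₁ ε)) ∘ α⇒)    ≈⟨ ∘ʳ (∘ʳ α-natural) ⟨
    λ⇒ ∘ (id ⊗₁ λ⇒) ∘ (α⇒ ∘ ((ε ⊗₁ ε) ⊗₁ ε))    ≈⟨ ∘ʳ (pullˡ triangle) ⟩
    λ⇒ ∘ (ρ⇒ ⊗₁ id) ∘ ((ε ⊗₁ ε) ⊗₁ ε)           ≈⟨ ∘ʳ (∘ˡ (⊗ˡ λ⇒≈ρ⇒)) ⟨
    λ⇒ ∘ (λ⇒ ⊗₁ id) ∘ ((ε ⊗₁ ε) ⊗₁ ε)           ≈⟨ ∘ʳ ∘-⊗ ⟩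
    λ⇒ ∘ ((λ⇒ ∘ (ε ⊗₁ ε)) ⊗₁ (id ∘ ε))          ≈⟨ ∘ʳ (⊗-resp-≈ (sym ε-⊗) identityˡ) ⟩
    λ⇒ ∘ (ε ⊗₁ ε)                               ≈⟨ ε-⊗ ⟨
    ε ∎

  Total-α⇐ : ∀ {A B C} → Total (α⇐ {A} {B} {C})
  Total-α⇐ = Total-inverse Total-α⇒ α-isoʳ

  Total-swapˡ : ∀ {A B C} → Total (swapˡ {A} {B} {C})
  Total-swapˡ = Total-∘ Total-α⇒ (Total-∘ (Total-⊗ Total-σ Total-id) Total-α⇐)

  Total-interchange : ∀ {A B C D} → Total (interchange {A} {B} {C} {D})
  Total-interchange = Total-∘ Total-α⇐ (Total-∘ (Total-⊗ Total-id Total-swapˡ) Total-α⇒)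

  Deterministic : ∀ {A B} → A ⇒ B → Set e
  Deterministic f = Δ ∘ f ≈ (f ⊗₁ f) ∘ Δ

  Deterministic-id : ∀ {A} → Deterministic (id {A})
  Deterministic-id = trans identityʳ (trans (sym identityˡ) (∘ˡ (sym ⊗-id)))

  Deterministic-∘ : ∀ {A B C} {f : B ⇒ C} {g : A ⇒ B} →
                    Deterministic f → Deterministic g → Deterministic (f ∘ g)
  Deterministic-∘ {f = f} {g} p q = begin
    Δ ∘ (f ∘ g)                ≈⟨ extendʳ p ⟩
    (f ⊗₁ f) ∘ (Δ ∘ g)         ≈⟨ ∘ʳ q ⟩
    (f ⊗₁ f) ∘ ((g ⊗₁ g) ∘ Δ)  ≈⟨ pullˡ ∘-⊗ ⟩
    ((f ∘ g) ⊗₁ (f ∘ g)) ∘ Δ ∎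

  Deterministic-⊗ : ∀ {A B C D} {f : A ⇒ B} {g : C ⇒ D} →
                    Deterministic f → Deterministic g → Deterministic (f ⊗₁ g)
  Deterministic-⊗ {f = f} {g} p q = begin
    Δ ∘ (f ⊗₁ g)                                       ≈⟨ ∘ˡ Δ-⊗ ⟩
    (interchange ∘ (Δ ⊗₁ Δ)) ∘ (f ⊗₁ g)                ≈⟨ assoc ⟩
    interchange ∘ ((Δ ⊗₁ Δ) ∘ (f ⊗₁ g))                ≈⟨ ∘ʳ (⊗-square p q) ⟩
    interchange ∘ (((f ⊗₁ f) ⊗₁ (g ⊗₁ g)) ∘ (Δ ⊗₁ Δ))  ≈⟨ extendʳ interchange-natural ⟩
    ((f ⊗₁ g) ⊗₁ (f ⊗₁ g)) ∘ (interchange ∘ (Δ ⊗₁ Δ))  ≈⟨ ∘ʳ Δ-⊗ ⟨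
    ((f ⊗₁ g) ⊗₁ (f ⊗₁ g)) ∘ Δ ∎

  Deterministic-ε : ∀ {A} → Deterministic (ε {A})
  Deterministic-ε = sym ε⊗ε∘Δ≈Δ∘ε

  Deterministic-λ⇒ : ∀ {A} → Deterministic (λ⇒ {A})
  Deterministic-λ⇒ = begin
    Δ ∘ λ⇒
      ≈⟨ λ-natural ⟨
    λ⇒ ∘ (id ⊗₁ Δ)
      ≈⟨ pullˡ λ⇒⊗λ⇒∘interchange∘Δ⊗id≈λ⇒ ⟨
    (λ⇒ ⊗₁ λ⇒) ∘ ((interchange ∘ (Δ ⊗₁ id)) ∘ (id ⊗₁ Δ))
      ≈⟨ ∘ʳ assoc ⟩
    (λ⇒ ⊗₁ λ⇒) ∘ (interchange ∘ ((Δ ⊗₁ id) ∘ (id ⊗₁ Δ)))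
      ≈⟨ ∘ʳ (∘ʳ (trans ∘-⊗ (⊗-resp-≈ identityʳ identityˡ))) ⟩
    (λ⇒ ⊗₁ λ⇒) ∘ (interchange ∘ (Δ ⊗₁ Δ))
      ≈⟨ ∘ʳ Δ-⊗ ⟨
    (λ⇒ ⊗₁ λ⇒) ∘ Δ ∎

  Deterministic-inverse : ∀ {A B} {f : A ⇒ B} {g : B ⇒ A} →
                          Deterministic f → f ∘ g ≈ id → g ∘ f ≈ id → Deterministic g
  Deterministic-inverse {f = f} {g} p fg gf = begin
    Δ ∘ g                            ≈⟨ cancelˡ (g⊗g∘f⊗f≈id) ⟨
    (g ⊗₁ g) ∘ ((f ⊗₁ f) ∘ (Δ ∘ g))  ≈⟨ ∘ʳ (extendʳ p) ⟨
    (g ⊗₁ g) ∘ (Δ ∘ (f ∘ g))         ≈⟨ ∘ʳ (∘ʳ fg) ⟩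
    (g ⊗₁ g) ∘ (Δ ∘ id)              ≈⟨ ∘ʳ identityʳ ⟩
    (g ⊗₁ g) ∘ Δ ∎
    where
    g⊗g∘f⊗f≈id : (g ⊗₁ g) ∘ (f ⊗₁ f) ≈ id
    g⊗g∘f⊗f≈id = trans ∘-⊗ (trans (⊗-resp-≈ gf gf) ⊗-id)

  Deterministic-λ⇐ : ∀ {A} → Deterministic (λ⇐ {A})
  Deterministic-λ⇐ = Deterministic-inverse Deterministic-λ⇒ λ-isoʳ λ-isoˡ

  ⟨_,_⟩ : ∀ {X A B} → X ⇒ A → X ⇒ B → X ⇒ (A ⊗₀ B)
  ⟨ f , g ⟩ = (f ⊗₁ g) ∘ Δ

  pair-map : ∀ {X A B A′ B′} {p : A ⇒ A′} {q : B ⇒ B′} {f : X ⇒ A} {g : X ⇒ B} →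
             (p ⊗₁ q) ∘ ⟨ f , g ⟩ ≈ ⟨ p ∘ f , q ∘ g ⟩
  pair-map = pullˡ ∘-⊗

  pair-resp : ∀ {X A B} {f f′ : X ⇒ A} {g g′ : X ⇒ B} → f ≈ f′ → g ≈ g′ → ⟨ f , g ⟩ ≈ ⟨ f′ , g′ ⟩
  pair-resp p q = ∘ˡ (⊗-resp-≈ p q)

  pair-swap : ∀ {X A B} {f : X ⇒ A} {g : X ⇒ B} → σ ∘ ⟨ f , g ⟩ ≈ ⟨ g , f ⟩
  pair-swap = trans (extendʳ σ-natural) (∘ʳ Δ-comm)

  coassoc⇐ : ∀ {X} → (Δ ⊗₁ id) ∘ Δ {X} ≈ α⇐ ∘ ((id ⊗₁ Δ) ∘ Δ)
  coassoc⇐ = trans (sym (cancelˡ α-isoˡ)) (∘ʳ Δ-coassoc)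

  pair-assoc : ∀ {X A B C} {f : X ⇒ A} {g : X ⇒ B} {h : X ⇒ C} →
               ⟨ ⟨ f , g ⟩ , h ⟩ ≈ α⇐ ∘ ⟨ f , ⟨ g , h ⟩ ⟩
  pair-assoc {f = f} {g} {h} = begin
    (((f ⊗₁ g) ∘ Δ) ⊗₁ h) ∘ Δ                 ≈⟨ ∘ˡ (trans (⊗ʳ (sym identityʳ)) ⊗-∘) ⟩
    (((f ⊗₁ g) ⊗₁ h) ∘ (Δ ⊗₁ id)) ∘ Δ         ≈⟨ assoc ⟩
    ((f ⊗₁ g) ⊗₁ h) ∘ ((Δ ⊗₁ id) ∘ Δ)         ≈⟨ ∘ʳ coassoc⇐ ⟩
    ((f ⊗₁ g) ⊗₁ h) ∘ (α⇐ ∘ ((id ⊗₁ Δ) ∘ Δ))  ≈⟨ extendʳ α⇐-natural ⟨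
    α⇐ ∘ ((f ⊗₁ (g ⊗₁ h)) ∘ ((id ⊗₁ Δ) ∘ Δ))  ≈⟨ ∘ʳ (pullˡ (trans ∘-⊗ (⊗ˡ identityʳ))) ⟩
    α⇐ ∘ ((f ⊗₁ ((g ⊗₁ h) ∘ Δ)) ∘ Δ) ∎

  pair-assoc⇒ : ∀ {X A B C} {f : X ⇒ A} {g : X ⇒ B} {h : X ⇒ C} →
                α⇒ ∘ ⟨ ⟨ f , g ⟩ , h ⟩ ≈ ⟨ f , ⟨ g , h ⟩ ⟩
  pair-assoc⇒ = trans (∘ʳ pair-assoc) (cancelˡ α-isoʳ)

  id⊗-pair : ∀ {X A B B′} {f : X ⇒ A} {g : X ⇒ B} {g′ : X ⇒ B′} {h : B ⇒ B′} →
             h ∘ g ≈ g′ → (id ⊗₁ h) ∘ ⟨ f , g ⟩ ≈ ⟨ f , g′ ⟩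
  id⊗-pair p = trans pair-map (pair-resp identityˡ p)

  ⊗id-pair : ∀ {X A A′ B} {f : X ⇒ A} {f′ : X ⇒ A′} {g : X ⇒ B} {h : A ⇒ A′} →
             h ∘ f ≈ f′ → (h ⊗₁ id) ∘ ⟨ f , g ⟩ ≈ ⟨ f′ , g ⟩
  ⊗id-pair p = trans pair-map (pair-resp p identityˡ)

  act-∘ : ∀ {X A B C} {g₁ : A ⇒ B} {g₂ : B ⇒ C} {a : X ⇒ A} {b : X ⇒ B} {c : X ⇒ C} →
          g₁ ∘ a ≈ b → g₂ ∘ b ≈ c → (g₂ ∘ g₁) ∘ a ≈ c
  act-∘ p q = trans assoc (trans (∘ʳ p) q)

  pair-⊗ : ∀ {X R A B C D} {a : X ⇒ A} {f : R ⇒ B} {b : X ⇒ C} {g : R ⇒ D} →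
           ⟨ a ⊗₁ f , b ⊗₁ g ⟩ ≈ interchange ∘ (⟨ a , b ⟩ ⊗₁ ⟨ f , g ⟩)
  pair-⊗ = begin
    _ ∘ Δ                         ≈⟨ ∘ʳ Δ-⊗ ⟩
    _ ∘ (interchange ∘ (Δ ⊗₁ Δ))  ≈⟨ extendʳ interchange-natural ⟨
    interchange ∘ (_ ∘ (Δ ⊗₁ Δ))  ≈⟨ ∘ʳ ∘-⊗ ⟩
    interchange ∘ (_ ⊗₁ _) ∎

  graph-deterministic : ∀ {X Z Y} {k : Z ⇒ Y} {z : X ⇒ Z} → Deterministic z →
                        (k ⊗₁ id) ∘ (Δ ∘ z) ≈ ⟨ k ∘ z , z ⟩
  graph-deterministic p = trans (∘ʳ p) (trans (pullˡ ∘-⊗) (∘ˡ (⊗ʳ identityˡ)))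

  pair-∘-deterministic : ∀ {X Z Y₁ Y₂} {k₁ : Z ⇒ Y₁} {k₂ : Z ⇒ Y₂} {z : X ⇒ Z} → Deterministic z →
                         ⟨ k₁ , k₂ ⟩ ∘ z ≈ ⟨ k₁ ∘ z , k₂ ∘ z ⟩
  pair-∘-deterministic dz = trans assoc (trans (∘ʳ dz) (pullˡ ∘-⊗))

  pair-total : ∀ {X A B} {f : X ⇒ A} {g : X ⇒ B} → Total f → Total g → Total ⟨ f , g ⟩
  pair-total p q = Total-∘ (Total-⊗ p q) Total-Δ

  π₁ : ∀ {A B} → A ⊗₀ B ⇒ A
  π₁ = ρ⇒ ∘ (id ⊗₁ ε)

  π₂ : ∀ {A B} → A ⊗₀ B ⇒ B
  π₂ = λ⇒ ∘ (ε ⊗₁ id)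

  Total-π₁ : ∀ {A B} → Total (π₁ {A} {B})
  Total-π₁ = Total-∘ Total-ρ⇒ (Total-⊗ Total-id Total-ε)

  Total-π₂ : ∀ {A B} → Total (π₂ {A} {B})
  Total-π₂ = Total-∘ Total-λ⇒ (Total-⊗ Total-ε Total-id)

  π₁-pair : ∀ {X A B} {f : X ⇒ A} {g : X ⇒ B} → Total g → π₁ ∘ ⟨ f , g ⟩ ≈ f
  π₁-pair {f = f} {g} q = begin
    (ρ⇒ ∘ (id ⊗₁ ε)) ∘ ((f ⊗₁ g) ∘ Δ)   ≈⟨ assoc ⟩
    ρ⇒ ∘ ((id ⊗₁ ε) ∘ ((f ⊗₁ g) ∘ Δ))   ≈⟨ ∘ʳ (pullˡ (trans ∘-⊗ (⊗-resp-≈ identityˡ q))) ⟩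
    ρ⇒ ∘ ((f ⊗₁ ε) ∘ Δ)                 ≈⟨ ∘ʳ (∘ˡ ⊗≈⊗id∘id⊗) ⟩
    ρ⇒ ∘ (((f ⊗₁ id) ∘ (id ⊗₁ ε)) ∘ Δ)  ≈⟨ ∘ʳ assoc ⟩
    ρ⇒ ∘ ((f ⊗₁ id) ∘ ((id ⊗₁ ε) ∘ Δ))  ≈⟨ ∘ʳ (∘ʳ Δ-counitʳ) ⟩
    ρ⇒ ∘ ((f ⊗₁ id) ∘ ρ⇐)               ≈⟨ pullˡ ρ-natural ⟩
    (f ∘ ρ⇒) ∘ ρ⇐                       ≈⟨ cancelʳ ρ-isoʳ ⟩
    f ∎

  π₂-pair : ∀ {X A B} {f : X ⇒ A} {g : X ⇒ B} → Total f → π₂ ∘ ⟨ f , g ⟩ ≈ g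
  π₂-pair {f = f} {g} q = begin
    (λ⇒ ∘ (ε ⊗₁ id)) ∘ ((f ⊗₁ g) ∘ Δ)   ≈⟨ assoc ⟩
    λ⇒ ∘ ((ε ⊗₁ id) ∘ ((f ⊗₁ g) ∘ Δ))   ≈⟨ ∘ʳ (pullˡ (trans ∘-⊗ (⊗-resp-≈ q identityˡ))) ⟩
    λ⇒ ∘ ((ε ⊗₁ g) ∘ Δ)                 ≈⟨ ∘ʳ (∘ˡ ⊗≈id⊗∘⊗id) ⟩
    λ⇒ ∘ (((id ⊗₁ g) ∘ (ε ⊗₁ id)) ∘ Δ)  ≈⟨ ∘ʳ assoc ⟩
    λ⇒ ∘ ((id ⊗₁ g) ∘ ((ε ⊗₁ id) ∘ Δ))  ≈⟨ ∘ʳ (∘ʳ Δ-counitˡ) ⟩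
    λ⇒ ∘ ((id ⊗₁ g) ∘ λ⇐)               ≈⟨ pullˡ λ-natural ⟩
    (g ∘ λ⇒) ∘ λ⇐                       ≈⟨ cancelʳ λ-isoʳ ⟩
    g ∎

module Conditioning {o ℓ e} (𝒞 : CDCategory o ℓ e) (ec : EffectConditioning 𝒞) where
  open CDCategory 𝒞
  open EffectConditioning ec
  open CDProperties 𝒞

  Partial : ∀ {X Y} → X ⇒ Y → Set e
  Partial f = PartialChannel 𝒞 f

  Partial-resp : ∀ {X Y} {f g : X ⇒ Y} → f ≈ g → Partial f → Partial g
  Partial-resp {f = f} {g} p q = begin
    g                          ≈⟨ p ⟨
    f                          ≈⟨ q ⟩
    ρ⇒ ∘ ((f ⊗₁ (ε ∘ f)) ∘ Δ)  ≈⟨ ∘ʳ (∘ˡ (⊗-resp-≈ p (∘ʳ p))) ⟩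
    ρ⇒ ∘ ((g ⊗₁ (ε ∘ g)) ∘ Δ) ∎

  Partial-∘-deterministic : ∀ {X Y Z} {p : Y ⇒ Z} {ψ : X ⇒ Y} →
                            Partial p → Deterministic ψ → Partial (p ∘ ψ)
  Partial-∘-deterministic {p = p} {ψ} pp dψ = begin
    p ∘ ψ                                   ≈⟨ ∘ˡ pp ⟩
    (ρ⇒ ∘ ((p ⊗₁ (ε ∘ p)) ∘ Δ)) ∘ ψ         ≈⟨ assoc ⟩
    ρ⇒ ∘ (((p ⊗₁ (ε ∘ p)) ∘ Δ) ∘ ψ)         ≈⟨ ∘ʳ assoc ⟩
    ρ⇒ ∘ ((p ⊗₁ (ε ∘ p)) ∘ (Δ ∘ ψ))         ≈⟨ ∘ʳ (∘ʳ dψ) ⟩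
    ρ⇒ ∘ ((p ⊗₁ (ε ∘ p)) ∘ ((ψ ⊗₁ ψ) ∘ Δ))  ≈⟨ ∘ʳ (pullˡ (trans ∘-⊗ (⊗ʳ assoc))) ⟩
    ρ⇒ ∘ (((p ∘ ψ) ⊗₁ (ε ∘ (p ∘ ψ))) ∘ Δ) ∎

  Total-∘-Partial : ∀ {X Y Z} {p : X ⇒ Y} {φ : Y ⇒ Z} → Partial p → Total φ → Partial (φ ∘ p)
  Total-∘-Partial {p = p} {φ} pp tφ = begin
    φ ∘ p                                    ≈⟨ ∘ʳ pp ⟩
    φ ∘ (ρ⇒ ∘ ((p ⊗₁ (ε ∘ p)) ∘ Δ))          ≈⟨ extendʳ ρ-natural ⟨
    ρ⇒ ∘ ((φ ⊗₁ id) ∘ ((p ⊗₁ (ε ∘ p)) ∘ Δ))  ≈⟨ ∘ʳ (pullˡ ∘-⊗) ⟩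
    ρ⇒ ∘ (((φ ∘ p) ⊗₁ (id ∘ (ε ∘ p))) ∘ Δ)   ≈⟨ ∘ʳ (∘ˡ (⊗ʳ (trans identityˡ (trans (∘ˡ (sym tφ)) assoc)))) ⟩
    ρ⇒ ∘ (((φ ∘ p) ⊗₁ (ε ∘ (φ ∘ p))) ∘ Δ) ∎

  ρ⇒-transpose : ∀ {X Y} {f : X ⇒ Y} {g : X ⇒ Y ⊗₀ I} → f ≈ ρ⇒ ∘ g → g ≈ ρ⇐ ∘ f
  ρ⇒-transpose p = trans (sym (cancelˡ ρ-isoˡ)) (∘ʳ (sym p))

  partial≈ρ⇒∘norm : ∀ {X Y} {q : X ⇒ Y} {u : X ⇒ I} → Partial q → ε ∘ q ≈ norm u →
                    q ≈ ρ⇒ ∘ norm ((q ⊗₁ u) ∘ Δ)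
  partial≈ρ⇒∘norm {q = q} {u} pq eq = begin
    q                              ≈⟨ pq ⟩
    ρ⇒ ∘ ((q ⊗₁ (ε ∘ q)) ∘ Δ)      ≈⟨ ∘ʳ (∘ˡ (⊗-resp-≈ (sym (N1 q pq)) eq)) ⟩
    ρ⇒ ∘ ((norm q ⊗₁ norm u) ∘ Δ)  ≈⟨ ∘ʳ (∘ˡ (N2 q u)) ⟨
    ρ⇒ ∘ (norm (q ⊗₁ u) ∘ Δ)       ≈⟨ ∘ʳ (N4 _) ⟨
    ρ⇒ ∘ norm ((q ⊗₁ u) ∘ Δ) ∎

  partial-cancel : ∀ {X Y} {q₁ q₂ : X ⇒ Y} {u : X ⇒ I} → Partial q₁ → Partial q₂ →
                   ε ∘ q₁ ≈ norm u → ε ∘ q₂ ≈ norm u → (q₁ ⊗₁ u) ∘ Δ ≈ (q₂ ⊗₁ u) ∘ Δ → q₁ ≈ q₂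
  partial-cancel p₁ p₂ e₁ e₂ eq =
    trans (partial≈ρ⇒∘norm p₁ e₁) (trans (∘ʳ (norm-resp-≈ eq)) (sym (partial≈ρ⇒∘norm p₂ e₂)))

  norm-unique : ∀ {X Y} {f : X ⇒ Y} {p : X ⇒ Y} → f ≈ ρ⇒ ∘ ((p ⊗₁ (ε ∘ f)) ∘ Δ) → Partial p →
                ε ∘ p ≈ norm (ε ∘ f) → norm f ≈ p
  norm-unique {f = f} {p} fp pp ep =
    partial-cancel (norm-partial f) pp (sym (N3 f)) ep
                   (trans (ρ⇒-transpose (N0 f)) (sym (ρ⇒-transpose fp)))

  capApply-resp : ∀ {A B X} {f g : A ⇒ B ⊗₀ X} → f ≈ g → capApply f ≈ capApply g
  capApply-resp p = ∘ʳ (∘ʳ (∘ʳ (⊗ˡ p)))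

  cond : ∀ {Y Z} → I ⇒ Y ⊗₀ Z → Z ⇒ Y
  cond s = stateConditional 𝒞 ec s

  cond-resp : ∀ {Y Z} {s t : I ⇒ Y ⊗₀ Z} → s ≈ t → cond s ≈ cond t
  cond-resp p = ∘ˡ (norm-resp-≈ (capApply-resp p))

  marg₂ : ∀ {Y Z} → I ⇒ Y ⊗₀ Z → I ⇒ Z
  marg₂ s = λ⇒ ∘ ((ε ⊗₁ id) ∘ s)

  ε⊗id∘α⇒ : ∀ {A B C} → (ε ⊗₁ id) ∘ α⇒ {A} {B} {C} ≈ α⇒ ∘ ((ε ⊗₁ id) ⊗₁ id)
  ε⊗id∘α⇒ = trans (∘ˡ (⊗ʳ (sym ⊗-id))) (sym α-natural)

  ε∘capApply : ∀ {Y Z} (s : I ⇒ Y ⊗₀ Z) → ε ∘ capApply s ≈ cap ∘ (marg₂ s ⊗₁ id)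
  ε∘capApply s = begin
    ε ∘ (ρ⇒ ∘ ((id ⊗₁ cap) ∘ (α⇒ ∘ (s ⊗₁ id))))                  ≈⟨ extendʳ ρ-natural ⟨
    ρ⇒ ∘ ((ε ⊗₁ id) ∘ ((id ⊗₁ cap) ∘ (α⇒ ∘ (s ⊗₁ id))))          ≈⟨ ∘ʳ (extendʳ ⊗id∘id⊗≈id⊗∘⊗id) ⟩
    ρ⇒ ∘ ((id ⊗₁ cap) ∘ ((ε ⊗₁ id) ∘ (α⇒ ∘ (s ⊗₁ id))))          ≈⟨ ∘ʳ (∘ʳ (extendʳ ε⊗id∘α⇒)) ⟩
    ρ⇒ ∘ ((id ⊗₁ cap) ∘ (α⇒ ∘ (((ε ⊗₁ id) ⊗₁ id) ∘ (s ⊗₁ id))))  ≈⟨ ∘ʳ (∘ʳ (∘ʳ ∘⊗id)) ⟩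
    ρ⇒ ∘ ((id ⊗₁ cap) ∘ (α⇒ ∘ (((ε ⊗₁ id) ∘ s) ⊗₁ id)))          ≈⟨ ∘ʳ (∘ʳ (∘ʳ (⊗ˡ (cancelˡ λ-isoˡ)))) ⟨
    ρ⇒ ∘ ((id ⊗₁ cap) ∘ (α⇒ ∘ ((λ⇐ ∘ marg₂ s) ⊗₁ id)))           ≈⟨ ∘ʳ (∘ʳ (∘ʳ ∘⊗id)) ⟨
    ρ⇒ ∘ ((id ⊗₁ cap) ∘ (α⇒ ∘ ((λ⇐ ⊗₁ id) ∘ (marg₂ s ⊗₁ id))))   ≈⟨ ∘ʳ (∘ʳ (pullˡ α⇒∘λ⇐⊗id≈λ⇐)) ⟩
    ρ⇒ ∘ ((id ⊗₁ cap) ∘ (λ⇐ ∘ (marg₂ s ⊗₁ id)))                  ≈⟨ ∘ʳ (extendʳ λ⇐-natural) ⟨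
    ρ⇒ ∘ (λ⇐ ∘ (cap ∘ (marg₂ s ⊗₁ id)))                          ≈⟨ pullˡ (trans (∘ʳ λ⇐≈ρ⇐) ρ-isoʳ) ⟩
    id ∘ (cap ∘ (marg₂ s ⊗₁ id))                                 ≈⟨ identityˡ ⟩
    cap ∘ (marg₂ s ⊗₁ id) ∎

  effect-copy-symmetric : ∀ {Z} {u : Z ⇒ I} → λ⇒ ∘ ((u ⊗₁ id) ∘ Δ) ≈ ρ⇒ ∘ ((id ⊗₁ u) ∘ Δ)
  effect-copy-symmetric {u = u} = begin
    λ⇒ ∘ ((u ⊗₁ id) ∘ Δ)        ≈⟨ ∘ˡ ρ⇒∘σ≈λ⇒ ⟨
    (ρ⇒ ∘ σ) ∘ ((u ⊗₁ id) ∘ Δ)  ≈⟨ assoc ⟩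
    ρ⇒ ∘ (σ ∘ ((u ⊗₁ id) ∘ Δ))  ≈⟨ ∘ʳ (extendʳ σ-natural) ⟩
    ρ⇒ ∘ ((id ⊗₁ u) ∘ (σ ∘ Δ))  ≈⟨ ∘ʳ (∘ʳ Δ-comm) ⟩
    ρ⇒ ∘ ((id ⊗₁ u) ∘ Δ) ∎

  copy-absorbs-effect : ∀ {Z} {u : I ⊗₀ Z ⇒ I} →
                        λ⇒ ∘ ((u ⊗₁ id) ∘ (α⇐ ∘ (id ⊗₁ Δ))) ≈ ρ⇒ ∘ ((λ⇒ ⊗₁ u) ∘ Δ)
  copy-absorbs-effect {u = u} = iso-cancelʳ λ-isoˡ (begin
    (λ⇒ ∘ ((u ⊗₁ id) ∘ (α⇐ ∘ (id ⊗₁ Δ)))) ∘ λ⇐  ≈⟨ assoc ⟩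
    λ⇒ ∘ (((u ⊗₁ id) ∘ (α⇐ ∘ (id ⊗₁ Δ))) ∘ λ⇐)  ≈⟨ ∘ʳ assoc ⟩
    λ⇒ ∘ ((u ⊗₁ id) ∘ ((α⇐ ∘ (id ⊗₁ Δ)) ∘ λ⇐))  ≈⟨ ∘ʳ (∘ʳ assoc) ⟩
    λ⇒ ∘ ((u ⊗₁ id) ∘ (α⇐ ∘ ((id ⊗₁ Δ) ∘ λ⇐)))  ≈⟨ ∘ʳ (∘ʳ (∘ʳ λ⇐-natural)) ⟨
    λ⇒ ∘ ((u ⊗₁ id) ∘ (α⇐ ∘ (λ⇐ ∘ Δ)))          ≈⟨ ∘ʳ (∘ʳ (pullˡ α⇐∘λ⇐≈λ⇐⊗id)) ⟩
    λ⇒ ∘ ((u ⊗₁ id) ∘ ((λ⇐ ⊗₁ id) ∘ Δ))         ≈⟨ ∘ʳ (pullˡ ∘⊗id) ⟩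
    λ⇒ ∘ (((u ∘ λ⇐) ⊗₁ id) ∘ Δ)                 ≈⟨ effect-copy-symmetric ⟩
    ρ⇒ ∘ ((id ⊗₁ (u ∘ λ⇐)) ∘ Δ)                 ≈⟨ ∘ʳ (∘ˡ (⊗ˡ λ-isoʳ)) ⟨
    ρ⇒ ∘ (((λ⇒ ∘ λ⇐) ⊗₁ (u ∘ λ⇐)) ∘ Δ)          ≈⟨ ∘ʳ (pullˡ ∘-⊗) ⟨
    ρ⇒ ∘ ((λ⇒ ⊗₁ u) ∘ ((λ⇐ ⊗₁ λ⇐) ∘ Δ))         ≈⟨ ∘ʳ (∘ʳ Deterministic-λ⇐) ⟨
    ρ⇒ ∘ ((λ⇒ ⊗₁ u) ∘ (Δ ∘ λ⇐))                 ≈⟨ ∘ʳ assoc ⟨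
    ρ⇒ ∘ (((λ⇒ ⊗₁ u) ∘ Δ) ∘ λ⇐)                 ≈⟨ assoc ⟨
    (ρ⇒ ∘ ((λ⇒ ⊗₁ u) ∘ Δ)) ∘ λ⇐ ∎)

  capApply-graph : ∀ {Y Z} (k : Z ⇒ Y) (t : I ⇒ Z) →
                   capApply ((k ⊗₁ id) ∘ (Δ ∘ t)) ≈ ρ⇒ ∘ (((k ∘ λ⇒) ⊗₁ (cap ∘ (t ⊗₁ id))) ∘ Δ)
  capApply-graph k t = begin
    ρ⇒ ∘ ((id ⊗₁ cap) ∘ (α⇒ ∘ (((k ⊗₁ id) ∘ (Δ ∘ t)) ⊗₁ id)))
      ≈⟨ ∘ʳ (∘ʳ (∘ʳ (trans (∘ʳ ∘⊗id) ∘⊗id))) ⟨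
    ρ⇒ ∘ ((id ⊗₁ cap) ∘ (α⇒ ∘ (((k ⊗₁ id) ⊗₁ id) ∘ ((Δ ⊗₁ id) ∘ (t ⊗₁ id)))))
      ≈⟨ ∘ʳ (∘ʳ (extendʳ (trans α-natural (∘ˡ (⊗ʳ ⊗-id))))) ⟩
    ρ⇒ ∘ ((id ⊗₁ cap) ∘ ((k ⊗₁ id) ∘ (α⇒ ∘ ((Δ ⊗₁ id) ∘ (t ⊗₁ id)))))
      ≈⟨ ∘ʳ (extendʳ ⊗id∘id⊗≈id⊗∘⊗id) ⟨
    ρ⇒ ∘ ((k ⊗₁ id) ∘ ((id ⊗₁ cap) ∘ (α⇒ ∘ ((Δ ⊗₁ id) ∘ (t ⊗₁ id)))))
      ≈⟨ extendʳ ρ-natural ⟩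
    k ∘ (ρ⇒ ∘ ((id ⊗₁ cap) ∘ (α⇒ ∘ ((Δ ⊗₁ id) ∘ (t ⊗₁ id)))))
      ≈⟨ ∘ʳ (trans (∘ʳ (∘ʳ sym-assoc)) (trans (∘ʳ sym-assoc) sym-assoc)) ⟩
    k ∘ ((ρ⇒ ∘ ((id ⊗₁ cap) ∘ (α⇒ ∘ (Δ ⊗₁ id)))) ∘ (t ⊗₁ id))
      ≈⟨ ∘ʳ (∘ˡ cap-Δ-swap) ⟨
    k ∘ ((λ⇒ ∘ ((cap ⊗₁ id) ∘ (α⇐ ∘ (id ⊗₁ Δ)))) ∘ (t ⊗₁ id))
      ≈⟨ ∘ʳ (trans assoc (∘ʳ (trans assoc (∘ʳ assoc)))) ⟩
    k ∘ (λ⇒ ∘ ((cap ⊗₁ id) ∘ (α⇐ ∘ ((id ⊗₁ Δ) ∘ (t ⊗₁ id)))))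
      ≈⟨ ∘ʳ (∘ʳ (∘ʳ (∘ʳ (⊗-square id-comm (trans identityʳ (sym (trans (∘ˡ ⊗-id) identityˡ))))))) ⟩
    k ∘ (λ⇒ ∘ ((cap ⊗₁ id) ∘ (α⇐ ∘ ((t ⊗₁ (id ⊗₁ id)) ∘ (id ⊗₁ Δ)))))
      ≈⟨ ∘ʳ (∘ʳ (∘ʳ (extendʳ α⇐-natural))) ⟩
    k ∘ (λ⇒ ∘ ((cap ⊗₁ id) ∘ (((t ⊗₁ id) ⊗₁ id) ∘ (α⇐ ∘ (id ⊗₁ Δ)))))
      ≈⟨ ∘ʳ (∘ʳ (pullˡ ∘⊗id)) ⟩
    k ∘ (λ⇒ ∘ (((cap ∘ (t ⊗₁ id)) ⊗₁ id) ∘ (α⇐ ∘ (id ⊗₁ Δ))))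
      ≈⟨ ∘ʳ copy-absorbs-effect ⟩
    k ∘ (ρ⇒ ∘ ((λ⇒ ⊗₁ (cap ∘ (t ⊗₁ id))) ∘ Δ))
      ≈⟨ extendʳ ρ-natural ⟨
    ρ⇒ ∘ ((k ⊗₁ id) ∘ ((λ⇒ ⊗₁ (cap ∘ (t ⊗₁ id))) ∘ Δ))
      ≈⟨ ∘ʳ (pullˡ (trans ∘-⊗ (⊗ʳ identityˡ))) ⟩
    ρ⇒ ∘ (((k ∘ λ⇒) ⊗₁ (cap ∘ (t ⊗₁ id))) ∘ Δ) ∎

  -- Caps are cancellative, so it suffices to compare capApply of both sides; there N0 applies.
  disintegration : ∀ {Y Z} (s : I ⇒ Y ⊗₀ Z) → s ≈ (cond s ⊗₁ id) ∘ (Δ ∘ marg₂ s)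
  disintegration s = cancellative s _ (begin
    capApply s
      ≈⟨ N0 (capApply s) ⟩
    ρ⇒ ∘ ((norm (capApply s) ⊗₁ (ε ∘ capApply s)) ∘ Δ)
      ≈⟨ ∘ʳ (∘ˡ (⊗-resp-≈ (sym (cancelʳ λ-isoˡ)) (ε∘capApply s))) ⟩
    ρ⇒ ∘ (((cond s ∘ λ⇒) ⊗₁ (cap ∘ (marg₂ s ⊗₁ id))) ∘ Δ)
      ≈⟨ capApply-graph (cond s) (marg₂ s) ⟨
    capApply ((cond s ⊗₁ id) ∘ (Δ ∘ marg₂ s)) ∎)

  cond-unique : ∀ {Y Z} (s : I ⇒ Y ⊗₀ Z) {k : Z ⇒ Y} → Partial k → ε ∘ k ≈ ε ∘ cond s →
                s ≈ (k ⊗₁ id) ∘ (Δ ∘ marg₂ s) → cond s ≈ k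
  cond-unique {Y} {Z} s {k} pk ek sk = trans (∘ˡ norm≈k∘λ⇒) (cancelʳ λ-isoʳ)
    where
    h : I ⊗₀ Z ⇒ Y
    h = capApply s
    h-decomposed : h ≈ ρ⇒ ∘ (((k ∘ λ⇒) ⊗₁ (ε ∘ h)) ∘ Δ)
    h-decomposed = trans (capApply-resp sk)
                         (trans (capApply-graph k (marg₂ s)) (∘ʳ (∘ˡ (⊗ʳ (sym (ε∘capApply s))))))
    support : ε ∘ (k ∘ λ⇒) ≈ norm (ε ∘ h)
    support = begin
      ε ∘ (k ∘ λ⇒)              ≈⟨ sym-assoc ⟩
      (ε ∘ k) ∘ λ⇒              ≈⟨ ∘ˡ ek ⟩
      (ε ∘ (norm h ∘ λ⇐)) ∘ λ⇒  ≈⟨ ∘ˡ sym-assoc ⟩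
      ((ε ∘ norm h) ∘ λ⇐) ∘ λ⇒  ≈⟨ cancelʳ λ-isoˡ ⟩
      ε ∘ norm h                ≈⟨ N3 h ⟨
      norm (ε ∘ h) ∎
    norm≈k∘λ⇒ : norm h ≈ k ∘ λ⇒
    norm≈k∘λ⇒ = norm-unique h-decomposed (Partial-∘-deterministic pk Deterministic-λ⇒) support

  ε∘cond : ∀ {Y Z} (s : I ⇒ Y ⊗₀ Z) → ε ∘ cond s ≈ norm (cap ∘ (marg₂ s ⊗₁ id)) ∘ λ⇐
  ε∘cond s = trans sym-assoc (∘ˡ (trans (sym (N3 _)) (norm-resp-≈ (ε∘capApply s))))

  ε∘cond-resp-marg₂ : ∀ {Y Y′ Z} (s : I ⇒ Y ⊗₀ Z) (t : I ⇒ Y′ ⊗₀ Z) →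
                      marg₂ s ≈ marg₂ t → ε ∘ cond s ≈ ε ∘ cond t
  ε∘cond-resp-marg₂ s t p = trans (ε∘cond s) (trans (∘ˡ (norm-resp-≈ (∘ʳ (⊗ˡ p)))) (sym (ε∘cond t)))

  Partial-cond : ∀ {Y Z} (s : I ⇒ Y ⊗₀ Z) → Partial (cond s)
  Partial-cond s = Partial-∘-deterministic (norm-partial _) Deterministic-λ⇐

  Partial-pair : ∀ {Z Y₁ Y₂} {k₁ : Z ⇒ Y₁} {k₂ : Z ⇒ Y₂} → Partial k₁ → Partial k₂ → Partial ⟨ k₁ , k₂ ⟩
  Partial-pair {k₁ = k₁} {k₂} p₁ p₂ = Partial-resp norm-pair (norm-partial _)
    where
    norm-pair : norm ⟨ k₁ , k₂ ⟩ ≈ ⟨ k₁ , k₂ ⟩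
    norm-pair = trans (N4 _) (∘ˡ (trans (N2 k₁ k₂) (⊗-resp-≈ (N1 k₁ p₁) (N1 k₂ p₂))))

  ε∘partial-idempotent : ∀ {Z Y} {k : Z ⇒ Y} → Partial k → ε ∘ k ≈ ρ⇒ ∘ (((ε ∘ k) ⊗₁ (ε ∘ k)) ∘ Δ)
  ε∘partial-idempotent {k = k} pk = begin
    ε ∘ k                                    ≈⟨ ∘ʳ pk ⟩
    ε ∘ (ρ⇒ ∘ ((k ⊗₁ (ε ∘ k)) ∘ Δ))          ≈⟨ extendʳ ρ-natural ⟨
    ρ⇒ ∘ ((ε ⊗₁ id) ∘ ((k ⊗₁ (ε ∘ k)) ∘ Δ))  ≈⟨ ∘ʳ (pullˡ (trans ∘-⊗ (⊗ʳ identityˡ))) ⟩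
    ρ⇒ ∘ (((ε ∘ k) ⊗₁ (ε ∘ k)) ∘ Δ) ∎

  ε∘pair-partial : ∀ {Z Y₁ Y₂} {k₁ : Z ⇒ Y₁} {k₂ : Z ⇒ Y₂} → Partial k₁ → ε ∘ k₂ ≈ ε ∘ k₁ →
                   ε ∘ ⟨ k₁ , k₂ ⟩ ≈ ε ∘ k₁
  ε∘pair-partial {k₁ = k₁} {k₂} p₁ e₂ = begin
    ε ∘ ((k₁ ⊗₁ k₂) ∘ Δ)               ≈⟨ pullˡ ε∘⊗ ⟩
    (λ⇒ ∘ ((ε ∘ k₁) ⊗₁ (ε ∘ k₂))) ∘ Δ  ≈⟨ assoc ⟩
    λ⇒ ∘ (((ε ∘ k₁) ⊗₁ (ε ∘ k₂)) ∘ Δ)  ≈⟨ ∘-resp-≈ λ⇒≈ρ⇒ (∘ˡ (⊗ʳ e₂)) ⟩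
    ρ⇒ ∘ (((ε ∘ k₁) ⊗₁ (ε ∘ k₁)) ∘ Δ)  ≈⟨ ε∘partial-idempotent p₁ ⟨
    ε ∘ k₁ ∎

  marg₂-post : ∀ {Y Y′ Z} {φ : Y ⇒ Y′} (s : I ⇒ Y ⊗₀ Z) → Total φ → marg₂ ((φ ⊗₁ id) ∘ s) ≈ marg₂ s
  marg₂-post s tφ = ∘ʳ (trans (pullˡ ∘⊗id) (∘ˡ (⊗ˡ tφ)))

  cond-post : ∀ {Y Y′ Z} {φ : Y ⇒ Y′} (s : I ⇒ Y ⊗₀ Z) → Total φ → cond ((φ ⊗₁ id) ∘ s) ≈ φ ∘ cond s
  cond-post {φ = φ} s tφ = cond-unique _ (Total-∘-Partial (Partial-cond s) tφ) support disintegrates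
    where
    support : ε ∘ (φ ∘ cond s) ≈ ε ∘ cond ((φ ⊗₁ id) ∘ s)
    support = trans sym-assoc (trans (∘ˡ tφ) (ε∘cond-resp-marg₂ s _ (sym (marg₂-post s tφ))))
    disintegrates : (φ ⊗₁ id) ∘ s ≈ ((φ ∘ cond s) ⊗₁ id) ∘ (Δ ∘ marg₂ ((φ ⊗₁ id) ∘ s))
    disintegrates = begin
      (φ ⊗₁ id) ∘ s                                 ≈⟨ ∘ʳ (disintegration s) ⟩
      (φ ⊗₁ id) ∘ ((cond s ⊗₁ id) ∘ (Δ ∘ marg₂ s))  ≈⟨ pullˡ ∘⊗id ⟩
      ((φ ∘ cond s) ⊗₁ id) ∘ (Δ ∘ marg₂ s)          ≈⟨ ∘ʳ (∘ʳ (marg₂-post s tφ)) ⟨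
      ((φ ∘ cond s) ⊗₁ id) ∘ (Δ ∘ marg₂ ((φ ⊗₁ id) ∘ s)) ∎

  module RandomVariables {W : Obj} (ω : I ⇒ W) where

    given : ∀ {Y Z} → W ⇒ Y → W ⇒ Z → Z ⇒ Y
    given x z = cond (⟨ x , z ⟩ ∘ ω)

    given-resp : ∀ {Y Z} {x x′ : W ⇒ Y} {z : W ⇒ Z} → x ≈ x′ → given x z ≈ given x′ z
    given-resp p = cond-resp (∘ˡ (pair-resp p refl))

    Independent : ∀ {Y₁ Y₂ Z} → W ⇒ Y₁ → W ⇒ Y₂ → W ⇒ Z → Set e
    Independent x y z = given ⟨ x , y ⟩ z ≈ ⟨ given x z , given y z ⟩

    -- In probabilistic notation, Disintegrates x z k says p(x, z) = k(x ∣ z) p(z), and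
    -- Factorises x y z k says p(x, y, z) = k(x ∣ z) p(y, z).
    Disintegrates : ∀ {Y Z} → W ⇒ Y → W ⇒ Z → Z ⇒ Y → Set e
    Disintegrates x z k = ⟨ x , z ⟩ ∘ ω ≈ ⟨ k ∘ z , z ⟩ ∘ ω

    Factorises : ∀ {X Y Z} → W ⇒ X → W ⇒ Y → W ⇒ Z → Z ⇒ X → Set e
    Factorises x y z k = ⟨ ⟨ x , y ⟩ , z ⟩ ∘ ω ≈ ⟨ ⟨ k ∘ z , y ⟩ , z ⟩ ∘ ω

    marg₂-pair : ∀ {Y Z} {x : W ⇒ Y} {z : W ⇒ Z} → Total x → marg₂ (⟨ x , z ⟩ ∘ ω) ≈ z ∘ ω
    marg₂-pair tx = trans (∘ʳ sym-assoc) (trans sym-assoc (∘ˡ (trans sym-assoc (π₂-pair tx))))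

    given-disintegrates : ∀ {Y Z} {x : W ⇒ Y} {z : W ⇒ Z} → Total x → Deterministic z →
                          Disintegrates x z (given x z)
    given-disintegrates {x = x} {z} tx dz = begin
      ⟨ x , z ⟩ ∘ ω                                    ≈⟨ disintegration _ ⟩
      (given x z ⊗₁ id) ∘ (Δ ∘ marg₂ (⟨ x , z ⟩ ∘ ω))  ≈⟨ ∘ʳ (∘ʳ (marg₂-pair tx)) ⟩
      (given x z ⊗₁ id) ∘ (Δ ∘ (z ∘ ω))                ≈⟨ ∘ʳ sym-assoc ⟩
      (given x z ⊗₁ id) ∘ ((Δ ∘ z) ∘ ω)                ≈⟨ sym-assoc ⟩
      ((given x z ⊗₁ id) ∘ (Δ ∘ z)) ∘ ω                ≈⟨ ∘ˡ (graph-deterministic dz) ⟩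
      ⟨ given x z ∘ z , z ⟩ ∘ ω ∎

    given-unique : ∀ {Y Z} {x : W ⇒ Y} {z : W ⇒ Z} {k : Z ⇒ Y} → Total x → Deterministic z →
                   Partial k → ε ∘ k ≈ ε ∘ given x z → Disintegrates x z k → given x z ≈ k
    given-unique {x = x} {z} {k} tx dz pk ek eq = cond-unique _ pk ek (begin
      ⟨ x , z ⟩ ∘ ω              ≈⟨ eq ⟩
      ⟨ k ∘ z , z ⟩ ∘ ω          ≈⟨ ∘ˡ (graph-deterministic dz) ⟨
      ((k ⊗₁ id) ∘ (Δ ∘ z)) ∘ ω  ≈⟨ assoc ⟩
      (k ⊗₁ id) ∘ ((Δ ∘ z) ∘ ω)  ≈⟨ ∘ʳ assoc ⟩
      (k ⊗₁ id) ∘ (Δ ∘ (z ∘ ω))  ≈⟨ ∘ʳ (∘ʳ (marg₂-pair tx)) ⟨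
      (k ⊗₁ id) ∘ (Δ ∘ marg₂ (⟨ x , z ⟩ ∘ ω)) ∎)

    given-support : ∀ {Y Y′ Z} {x : W ⇒ Y} {x′ : W ⇒ Y′} {z : W ⇒ Z} → Total x → Total x′ →
                    ε ∘ given x z ≈ ε ∘ given x′ z
    given-support tx tx′ = ε∘cond-resp-marg₂ _ _ (trans (marg₂-pair tx) (sym (marg₂-pair tx′)))

    given-post : ∀ {Y Y′ Z} {φ : Y ⇒ Y′} {x : W ⇒ Y} {z : W ⇒ Z} → Total φ →
                 given (φ ∘ x) z ≈ φ ∘ given x z
    given-post tφ = trans (cond-resp (trans (∘ˡ (sym (⊗id-pair refl))) assoc)) (cond-post _ tφ)

    Independent-post : ∀ {Y₁ Y₂ Y₂′ Z} {x : W ⇒ Y₁} {y : W ⇒ Y₂} {y′ : W ⇒ Y₂′} {z : W ⇒ Z}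
                       {φ : Y₂ ⇒ Y₂′} → Total φ → y′ ≈ φ ∘ y → Independent x y z → Independent x y′ z
    Independent-post {x = x} {y} {y′} {z} {φ} tφ y′≈φy xy = begin
      given ⟨ x , y′ ⟩ z                     ≈⟨ given-resp (id⊗-pair (sym y′≈φy)) ⟨
      given ((id ⊗₁ φ) ∘ ⟨ x , y ⟩) z        ≈⟨ given-post (Total-⊗ Total-id tφ) ⟩
      (id ⊗₁ φ) ∘ given ⟨ x , y ⟩ z          ≈⟨ ∘ʳ xy ⟩
      (id ⊗₁ φ) ∘ ⟨ given x z , given y z ⟩  ≈⟨ id⊗-pair (sym (trans (given-resp y′≈φy) (given-post tφ))) ⟩
      ⟨ given x z , given y′ z ⟩ ∎

    Independent-decomposition : ∀ {X Y₁ Y₂ Z} {x : W ⇒ X} {y₁ : W ⇒ Y₁} {y₂ : W ⇒ Y₂} {z : W ⇒ Z} →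
                                Total y₁ → Total y₂ → Independent x ⟨ y₁ , y₂ ⟩ z →
                                Independent x y₁ z × Independent x y₂ z
    Independent-decomposition ty₁ ty₂ h =
      Independent-post Total-π₁ (sym (π₁-pair ty₂)) h , Independent-post Total-π₂ (sym (π₂-pair ty₁)) h

    Independent-sym : ∀ {Y₁ Y₂ Z} {x : W ⇒ Y₁} {y : W ⇒ Y₂} {z : W ⇒ Z} →
                      Independent x y z → Independent y x z
    Independent-sym {x = x} {y} {z} xy = begin
      given ⟨ y , x ⟩ z              ≈⟨ given-resp pair-swap ⟨
      given (σ ∘ ⟨ x , y ⟩) z        ≈⟨ given-post Total-σ ⟩
      σ ∘ given ⟨ x , y ⟩ z          ≈⟨ ∘ʳ xy ⟩
      σ ∘ ⟨ given x z , given y z ⟩  ≈⟨ pair-swap ⟩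
      ⟨ given y z , given x z ⟩ ∎

    pushforward : ∀ {A B} {T T′ : W ⇒ A} {S S′ : W ⇒ B} (G : B ⇒ A) →
                  G ∘ S ≈ T → G ∘ S′ ≈ T′ → S ∘ ω ≈ S′ ∘ ω → T ∘ ω ≈ T′ ∘ ω
    pushforward G p q r =
      trans (∘ˡ (sym p)) (trans assoc (trans (∘ʳ r) (trans sym-assoc (∘ˡ q))))

    adjoin-kernelʳ : ∀ {X Z K} {x₁ x₂ : W ⇒ X} {z : W ⇒ Z} (k : Z ⇒ K) → Deterministic z →
                     ⟨ x₁ , z ⟩ ∘ ω ≈ ⟨ x₂ , z ⟩ ∘ ω →
                     ⟨ ⟨ x₁ , k ∘ z ⟩ , z ⟩ ∘ ω ≈ ⟨ ⟨ x₂ , k ∘ z ⟩ , z ⟩ ∘ ω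
    adjoin-kernelʳ k dz = pushforward (α⇐ ∘ (id ⊗₁ ⟨ k , id ⟩)) adjoin adjoin
      where
      adjoin : ∀ {X} {x : W ⇒ X} → (α⇐ ∘ (id ⊗₁ ⟨ k , id ⟩)) ∘ ⟨ x , _ ⟩ ≈ ⟨ ⟨ x , k ∘ _ ⟩ , _ ⟩
      adjoin = trans assoc (trans (∘ʳ (id⊗-pair (trans assoc (graph-deterministic dz))))
                                  (sym pair-assoc))

    adjoin-kernelˡ : ∀ {X Z K} {x₁ x₂ : W ⇒ X} {z : W ⇒ Z} (k : Z ⇒ K) → Deterministic z →
                     ⟨ x₁ , z ⟩ ∘ ω ≈ ⟨ x₂ , z ⟩ ∘ ω →
                     ⟨ ⟨ k ∘ z , x₁ ⟩ , z ⟩ ∘ ω ≈ ⟨ ⟨ k ∘ z , x₂ ⟩ , z ⟩ ∘ ω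
    adjoin-kernelˡ k dz eq =
      pushforward (σ ⊗₁ id) (⊗id-pair pair-swap) (⊗id-pair pair-swap) (adjoin-kernelʳ k dz eq)

    Factorises⇒Disintegrates : ∀ {X Y Z} {x : W ⇒ X} {y : W ⇒ Y} {z : W ⇒ Z} {k : Z ⇒ X} →
                               Total y → Factorises x y z k → Disintegrates x z k
    Factorises⇒Disintegrates ty = pushforward (π₁ ⊗₁ id) (⊗id-pair (π₁-pair ty)) (⊗id-pair (π₁-pair ty))

    Factorises-resp : ∀ {X Y Z} {x : W ⇒ X} {y : W ⇒ Y} {z : W ⇒ Z} {k₁ k₂ : Z ⇒ X} →
                      Total y → Deterministic z → ⟨ k₁ ∘ z , z ⟩ ∘ ω ≈ ⟨ k₂ ∘ z , z ⟩ ∘ ω →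
                      Factorises x y z k₁ → Factorises x y z k₂
    Factorises-resp {z = z} {k₁} {k₂} ty dz k₁≈k₂ f = begin
      _                                       ≈⟨ f ⟩
      ⟨ ⟨ k₁ ∘ z , _ ⟩ , z ⟩ ∘ ω              ≈⟨ adjoin-kernelˡ k₁ dz (given-disintegrates ty dz) ⟩
      ⟨ ⟨ k₁ ∘ z , given _ z ∘ z ⟩ , z ⟩ ∘ ω  ≈⟨ adjoin-kernelʳ (given _ z) dz k₁≈k₂ ⟩
      ⟨ ⟨ k₂ ∘ z , given _ z ∘ z ⟩ , z ⟩ ∘ ω  ≈⟨ adjoin-kernelˡ k₂ dz (given-disintegrates ty dz) ⟨
      ⟨ ⟨ k₂ ∘ z , _ ⟩ , z ⟩ ∘ ω ∎

    Independent⇒Factorises : ∀ {X Y Z} {x : W ⇒ X} {y : W ⇒ Y} {z : W ⇒ Z} →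
                             Total x → Total y → Deterministic z →
                             Independent x y z → Factorises x y z (given x z)
    Independent⇒Factorises {x = x} {y} {z} tx ty dz xy = begin
      ⟨ ⟨ x , y ⟩ , z ⟩ ∘ ω
        ≈⟨ given-disintegrates (pair-total tx ty) dz ⟩
      ⟨ given ⟨ x , y ⟩ z ∘ z , z ⟩ ∘ ω
        ≈⟨ ∘ˡ (pair-resp (trans (∘ˡ xy) (pair-∘-deterministic dz)) refl) ⟩
      ⟨ ⟨ given x z ∘ z , given y z ∘ z ⟩ , z ⟩ ∘ ω
        ≈⟨ adjoin-kernelˡ (given x z) dz (given-disintegrates ty dz) ⟨
      ⟨ ⟨ given x z ∘ z , y ⟩ , z ⟩ ∘ ω ∎

    Factorises⇒Independent : ∀ {X Y Z} {x : W ⇒ X} {y : W ⇒ Y} {z : W ⇒ Z} {k : Z ⇒ X} →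
                             Total x → Total y → Deterministic z →
                             Factorises x y z k → Independent x y z
    Factorises⇒Independent {x = x} {y} {z} {k} tx ty dz f =
      given-unique (pair-total tx ty) dz (Partial-pair (Partial-cond _) (Partial-cond _)) support (begin
        ⟨ ⟨ x , y ⟩ , z ⟩ ∘ ω
          ≈⟨ Factorises-resp ty dz k≈given f ⟩
        ⟨ ⟨ given x z ∘ z , y ⟩ , z ⟩ ∘ ω
          ≈⟨ adjoin-kernelˡ (given x z) dz (given-disintegrates ty dz) ⟩
        ⟨ ⟨ given x z ∘ z , given y z ∘ z ⟩ , z ⟩ ∘ ω
          ≈⟨ ∘ˡ (pair-resp (pair-∘-deterministic dz) refl) ⟨
        ⟨ ⟨ given x z , given y z ⟩ ∘ z , z ⟩ ∘ ω      ∎)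
      where
      k≈given : ⟨ k ∘ z , z ⟩ ∘ ω ≈ ⟨ given x z ∘ z , z ⟩ ∘ ω
      k≈given = trans (sym (Factorises⇒Disintegrates ty f)) (given-disintegrates tx dz)
      support : ε ∘ ⟨ given x z , given y z ⟩ ≈ ε ∘ given ⟨ x , y ⟩ z
      support = trans (ε∘pair-partial (Partial-cond _) (given-support ty tx))
                      (given-support tx (pair-total tx ty))

    -- v plays the role of the marginal on C ∪ D, identified with ⟨ c , d ⟩ by S and J.
    module JointConditioning {C D V} {c : W ⇒ C} {d : W ⇒ D} {v : W ⇒ V}
             {S : V ⇒ C ⊗₀ D} {J : C ⊗₀ D ⇒ V}
             (Sv≈cd : S ∘ v ≈ ⟨ c , d ⟩) (Jcd≈v : J ∘ ⟨ c , d ⟩ ≈ v)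
             (td : Total d) (dc : Deterministic c) (dv : Deterministic v) where

      lift : ∀ {X} → C ⇒ X → V ⇒ X
      lift k = k ∘ (π₁ ∘ S)

      lift-∘ : ∀ {X} {k : C ⇒ X} → lift k ∘ v ≈ k ∘ c
      lift-∘ = trans assoc (∘ʳ (trans assoc (trans (∘ʳ Sv≈cd) (π₁-pair td))))

      Factorises-joint : ∀ {A B} {a : W ⇒ A} {b : W ⇒ B} {k : C ⇒ A} →
                         Factorises a ⟨ b , d ⟩ c k → Factorises a b v (lift k)
      Factorises-joint f =
        trans (pushforward G regroup regroup f) (∘ˡ (pair-resp (pair-resp (sym lift-∘) refl) refl))
        where
        G : ∀ {X Y} → (X ⊗₀ (Y ⊗₀ D)) ⊗₀ C ⇒ (X ⊗₀ Y) ⊗₀ V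
        G = (id ⊗₁ J) ∘ (α⇐ ∘ ((id ⊗₁ ((id ⊗₁ σ) ∘ α⇒)) ∘ α⇒))
        regroup : ∀ {X Y} {x : W ⇒ X} {y : W ⇒ Y} → G ∘ ⟨ ⟨ x , ⟨ y , d ⟩ ⟩ , c ⟩ ≈ ⟨ ⟨ x , y ⟩ , v ⟩
        regroup = act-∘ (act-∘ (act-∘ pair-assoc⇒ (id⊗-pair (act-∘ pair-assoc⇒ (id⊗-pair pair-swap))))
                               (sym pair-assoc))
                        (id⊗-pair Jcd≈v)

      Factorises-unjoint : ∀ {A B} {a : W ⇒ A} {b : W ⇒ B} {k : C ⇒ A} →
                           Factorises a b v (lift k) → Factorises a ⟨ b , d ⟩ c k
      Factorises-unjoint f =
        pushforward G regroup regroup (trans f (∘ˡ (pair-resp (pair-resp lift-∘ refl) refl)))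
        where
        G : ∀ {X Y} → (X ⊗₀ Y) ⊗₀ V ⇒ (X ⊗₀ (Y ⊗₀ D)) ⊗₀ C
        G = α⇐ ∘ ((id ⊗₁ (α⇐ ∘ (id ⊗₁ σ))) ∘ (α⇒ ∘ (id ⊗₁ S)))
        regroup : ∀ {X Y} {x : W ⇒ X} {y : W ⇒ Y} → G ∘ ⟨ ⟨ x , y ⟩ , v ⟩ ≈ ⟨ ⟨ x , ⟨ y , d ⟩ ⟩ , c ⟩
        regroup = act-∘ (act-∘ (act-∘ (id⊗-pair Sv≈cd) pair-assoc⇒)
                               (id⊗-pair (act-∘ (id⊗-pair pair-swap) (sym pair-assoc))))
                        (sym pair-assoc)

      Factorises⇒Disintegrates-joint : ∀ {A} {a : W ⇒ A} {k : C ⇒ A} →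
                                       Factorises a d c k → Disintegrates a v (lift k)
      Factorises⇒Disintegrates-joint f =
        trans (pushforward G regroup regroup f) (∘ˡ (pair-resp (sym lift-∘) refl))
        where
        G : ∀ {X} → (X ⊗₀ D) ⊗₀ C ⇒ X ⊗₀ V
        G = (id ⊗₁ J) ∘ ((id ⊗₁ σ) ∘ α⇒)
        regroup : ∀ {X} {x : W ⇒ X} → G ∘ ⟨ ⟨ x , d ⟩ , c ⟩ ≈ ⟨ x , v ⟩
        regroup = act-∘ (act-∘ pair-assoc⇒ (id⊗-pair pair-swap)) (id⊗-pair Jcd≈v)

      weak-union : ∀ {A B} {a : W ⇒ A} {b : W ⇒ B} → Total a → Total b →
                   Independent a ⟨ b , d ⟩ c → Independent a b v
      weak-union ta tb a⊥bd =
        Factorises⇒Independent ta tb dv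
          (Factorises-joint (Independent⇒Factorises ta (pair-total tb td) dc a⊥bd))

      contraction : ∀ {A B} {a : W ⇒ A} {b : W ⇒ B} → Total a → Total b →
                    Independent a b v → Independent a d c → Independent a ⟨ b , d ⟩ c
      contraction {a = a} ta tb a⊥b a⊥d =
        Factorises⇒Independent ta (pair-total tb td) dc
          (Factorises-unjoint (Factorises-resp tb dv given≈lift (Independent⇒Factorises ta tb dv a⊥b)))
        where
        given≈lift : ⟨ given a v ∘ v , v ⟩ ∘ ω ≈ ⟨ lift (given a c) ∘ v , v ⟩ ∘ ω
        given≈lift = trans (sym (given-disintegrates ta dv))
                           (Factorises⇒Disintegrates-joint (Independent⇒Factorises ta td dc a⊥d))

Disjoint-tail : ∀ {n} s t {S T : Subset n} → Disjoint (s ∷ S) (t ∷ T) → Disjoint S T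
Disjoint-tail s t d (x , p) = d (suc x , there p)

Disjoint-both⇒⊥ : ∀ {n} {S T : Subset n} → Disjoint (true ∷ S) (true ∷ T) → ⊥
Disjoint-both⇒⊥ d = d (zero , here)

module SubsetMaps {o ℓ e} (𝒞 : CDCategory o ℓ e) (ec : EffectConditioning 𝒞) where
  open CDCategory 𝒞
  open CDProperties 𝒞

  proj : ∀ {n} (S : Subset n) (Xs : Vec Obj n) → Xall 𝒞 ec Xs ⇒ Xₛ 𝒞 ec Xs S
  proj S Xs = marg 𝒞 ec S Xs

  sep : ∀ {n} (S T : Subset n) (Xs : Vec Obj n) → Xₛ 𝒞 ec Xs (S ∪ T) ⇒ (Xₛ 𝒞 ec Xs S ⊗₀ Xₛ 𝒞 ec Xs T)
  sep S T Xs = split 𝒞 ec S T Xs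

  join : ∀ {n} (S T : Subset n) (Xs : Vec Obj n) → (Xₛ 𝒞 ec Xs S ⊗₀ Xₛ 𝒞 ec Xs T) ⇒ Xₛ 𝒞 ec Xs (S ∪ T)
  join [] [] [] = λ⇒
  -- Only reached for overlapping subsets, where sep copies the shared factor.
  join (true ∷ S) (true ∷ T) (x ∷ xs) = (id ⊗₁ join S T xs) ∘ (α⇒ ∘ (id ⊗₁ π₂))
  join (true ∷ S) (false ∷ T) (x ∷ xs) = (id ⊗₁ join S T xs) ∘ α⇒
  join (false ∷ S) (true ∷ T) (x ∷ xs) = (id ⊗₁ join S T xs) ∘ swapˡ
  join (false ∷ S) (false ∷ T) (x ∷ xs) = join S T xs

  proj-total : ∀ {n} (S : Subset n) (Xs : Vec Obj n) → Total (proj S Xs)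
  proj-total [] [] = Total-id
  proj-total (true ∷ S) (x ∷ xs) = Total-⊗ Total-id (proj-total S xs)
  proj-total (false ∷ S) (x ∷ xs) = Total-∘ Total-λ⇒ (Total-⊗ Total-ε (proj-total S xs))

  proj-deterministic : ∀ {n} (S : Subset n) (Xs : Vec Obj n) → Deterministic (proj S Xs)
  proj-deterministic [] [] = Deterministic-id
  proj-deterministic (true ∷ S) (x ∷ xs) = Deterministic-⊗ Deterministic-id (proj-deterministic S xs)
  proj-deterministic (false ∷ S) (x ∷ xs) =
    Deterministic-∘ Deterministic-λ⇒ (Deterministic-⊗ Deterministic-ε (proj-deterministic S xs))

  sep-total : ∀ {n} (S T : Subset n) (Xs : Vec Obj n) → Total (sep S T Xs)
  sep-total [] [] [] = Total-λ⇐
  sep-total (true ∷ S) (true ∷ T) (x ∷ xs) =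
    Total-∘ Total-interchange (Total-⊗ Total-Δ (sep-total S T xs))
  sep-total (true ∷ S) (false ∷ T) (x ∷ xs) = Total-∘ Total-α⇐ (Total-⊗ Total-id (sep-total S T xs))
  sep-total (false ∷ S) (true ∷ T) (x ∷ xs) =
    Total-∘ Total-α⇒ (Total-∘ (Total-⊗ Total-σ Total-id)
                              (Total-∘ Total-α⇐ (Total-⊗ Total-id (sep-total S T xs))))
  sep-total (false ∷ S) (false ∷ T) (x ∷ xs) = sep-total S T xs

  join-total : ∀ {n} (S T : Subset n) (Xs : Vec Obj n) → Total (join S T Xs)
  join-total [] [] [] = Total-λ⇒
  join-total (true ∷ S) (true ∷ T) (x ∷ xs) =
    Total-∘ (Total-⊗ Total-id (join-total S T xs)) (Total-∘ Total-α⇒ (Total-⊗ Total-id Total-π₂))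
  join-total (true ∷ S) (false ∷ T) (x ∷ xs) = Total-∘ (Total-⊗ Total-id (join-total S T xs)) Total-α⇒
  join-total (false ∷ S) (true ∷ T) (x ∷ xs) =
    Total-∘ (Total-⊗ Total-id (join-total S T xs)) Total-swapˡ
  join-total (false ∷ S) (false ∷ T) (x ∷ xs) = join-total S T xs

  join∘sep≈id : ∀ {n} (S T : Subset n) (Xs : Vec Obj n) → Disjoint S T → join S T Xs ∘ sep S T Xs ≈ id
  join∘sep≈id [] [] [] _ = λ-isoʳ
  join∘sep≈id (true ∷ S) (true ∷ T) (x ∷ xs) d = ⊥-elim (Disjoint-both⇒⊥ d)
  join∘sep≈id (true ∷ S) (false ∷ T) (x ∷ xs) d₀ = begin
    ((id ⊗₁ j) ∘ α⇒) ∘ (α⇐ ∘ (id ⊗₁ s))  ≈⟨ assoc ⟩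
    (id ⊗₁ j) ∘ (α⇒ ∘ (α⇐ ∘ (id ⊗₁ s)))  ≈⟨ ∘ʳ (cancelˡ α-isoʳ) ⟩
    (id ⊗₁ j) ∘ (id ⊗₁ s)                ≈⟨ id⊗∘ ⟩
    id ⊗₁ (j ∘ s)                        ≈⟨ ⊗ʳ (join∘sep≈id S T xs (Disjoint-tail true false d₀)) ⟩
    id ⊗₁ id                             ≈⟨ ⊗-id ⟩
    id ∎
    where
    j : Xₛ 𝒞 ec xs S ⊗₀ Xₛ 𝒞 ec xs T ⇒ Xₛ 𝒞 ec xs (S ∪ T)
    j = join S T xs
    s : Xₛ 𝒞 ec xs (S ∪ T) ⇒ Xₛ 𝒞 ec xs S ⊗₀ Xₛ 𝒞 ec xs T
    s = sep S T xs
  join∘sep≈id (false ∷ S) (true ∷ T) (x ∷ xs) d₀ = begin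
    ((id ⊗₁ j) ∘ (α⇒ ∘ ((σ ⊗₁ id) ∘ α⇐))) ∘ (α⇒ ∘ ((σ ⊗₁ id) ∘ (α⇐ ∘ (id ⊗₁ s))))
      ≈⟨ assoc ⟩
    (id ⊗₁ j) ∘ ((α⇒ ∘ ((σ ⊗₁ id) ∘ α⇐)) ∘ (α⇒ ∘ ((σ ⊗₁ id) ∘ (α⇐ ∘ (id ⊗₁ s)))))
      ≈⟨ ∘ʳ (trans assoc (∘ʳ assoc)) ⟩
    (id ⊗₁ j) ∘ (α⇒ ∘ ((σ ⊗₁ id) ∘ (α⇐ ∘ (α⇒ ∘ ((σ ⊗₁ id) ∘ (α⇐ ∘ (id ⊗₁ s)))))))
      ≈⟨ ∘ʳ (∘ʳ (∘ʳ (cancelˡ α-isoˡ))) ⟩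
    (id ⊗₁ j) ∘ (α⇒ ∘ ((σ ⊗₁ id) ∘ ((σ ⊗₁ id) ∘ (α⇐ ∘ (id ⊗₁ s)))))
      ≈⟨ ∘ʳ (∘ʳ (cancelˡ (⊗id-iso σ-invol))) ⟩
    (id ⊗₁ j) ∘ (α⇒ ∘ (α⇐ ∘ (id ⊗₁ s)))
      ≈⟨ ∘ʳ (cancelˡ α-isoʳ) ⟩
    (id ⊗₁ j) ∘ (id ⊗₁ s)  ≈⟨ id⊗∘ ⟩
    id ⊗₁ (j ∘ s)          ≈⟨ ⊗ʳ (join∘sep≈id S T xs (Disjoint-tail false true d₀)) ⟩
    id ⊗₁ id               ≈⟨ ⊗-id ⟩
    id ∎
    where
    j : Xₛ 𝒞 ec xs S ⊗₀ Xₛ 𝒞 ec xs T ⇒ Xₛ 𝒞 ec xs (S ∪ T)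
    j = join S T xs
    s : Xₛ 𝒞 ec xs (S ∪ T) ⇒ Xₛ 𝒞 ec xs S ⊗₀ Xₛ 𝒞 ec xs T
    s = sep S T xs
  join∘sep≈id (false ∷ S) (false ∷ T) (x ∷ xs) d = join∘sep≈id S T xs (Disjoint-tail false false d)

  sep∘proj≈pair : ∀ {n} (S T : Subset n) (Xs : Vec Obj n) →
                  sep S T Xs ∘ proj (S ∪ T) Xs ≈ ⟨ proj S Xs , proj T Xs ⟩
  sep∘proj≈pair [] [] [] = trans identityʳ (sym (trans id⊗id∘ Δ-I))
  sep∘proj≈pair (true ∷ S) (true ∷ T) (x ∷ xs) = begin
    (interchange ∘ (Δ ⊗₁ sep S T xs)) ∘ (id ⊗₁ proj (S ∪ T) xs)
      ≈⟨ assoc ⟩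
    interchange ∘ ((Δ ⊗₁ sep S T xs) ∘ (id ⊗₁ proj (S ∪ T) xs))
      ≈⟨ ∘ʳ ∘-⊗ ⟩
    interchange ∘ ((Δ ∘ id) ⊗₁ (sep S T xs ∘ proj (S ∪ T) xs))
      ≈⟨ ∘ʳ (⊗-resp-≈ (trans identityʳ (sym id⊗id∘)) (sep∘proj≈pair S T xs)) ⟩
    interchange ∘ (((id ⊗₁ id) ∘ Δ) ⊗₁ ⟨ proj S xs , proj T xs ⟩)
      ≈⟨ pair-⊗ ⟨
    ((id ⊗₁ proj S xs) ⊗₁ (id ⊗₁ proj T xs)) ∘ Δ ∎
  sep∘proj≈pair (true ∷ S) (false ∷ T) (x ∷ xs) = begin
    (α⇐ ∘ (id ⊗₁ sep S T xs)) ∘ (id ⊗₁ proj (S ∪ T) xs)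
      ≈⟨ assoc ⟩
    α⇐ ∘ ((id ⊗₁ sep S T xs) ∘ (id ⊗₁ proj (S ∪ T) xs))
      ≈⟨ ∘ʳ (trans id⊗∘ (⊗ʳ (sep∘proj≈pair S T xs))) ⟩
    α⇐ ∘ (id ⊗₁ proj-pair)
      ≈⟨ ∘ˡ interchange∘ρ⇐⊗id-cancel ⟨
    (((id ⊗₁ id) ⊗₁ λ⇒) ∘ (interchange ∘ (ρ⇐ ⊗₁ id))) ∘ (id ⊗₁ proj-pair)
      ≈⟨ trans assoc (∘ʳ assoc) ⟩
    ((id ⊗₁ id) ⊗₁ λ⇒) ∘ (interchange ∘ ((ρ⇐ ⊗₁ id) ∘ (id ⊗₁ proj-pair)))
      ≈⟨ ∘ʳ (∘ʳ (trans ∘-⊗ (⊗-resp-≈ (trans identityʳ (sym Δ-counitʳ)) identityˡ))) ⟩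
    ((id ⊗₁ id) ⊗₁ λ⇒) ∘ (interchange ∘ (((id ⊗₁ ε) ∘ Δ) ⊗₁ proj-pair))
      ≈⟨ ∘ʳ pair-⊗ ⟨
    ((id ⊗₁ id) ⊗₁ λ⇒) ∘ (((id ⊗₁ proj S xs) ⊗₁ (ε ⊗₁ proj T xs)) ∘ Δ)
      ≈⟨ pullˡ (trans ∘-⊗ (⊗ˡ id⊗id∘)) ⟩
    ((id ⊗₁ proj S xs) ⊗₁ (λ⇒ ∘ (ε ⊗₁ proj T xs))) ∘ Δ ∎
    where
    proj-pair : Xall 𝒞 ec xs ⇒ Xₛ 𝒞 ec xs S ⊗₀ Xₛ 𝒞 ec xs T
    proj-pair = ⟨ proj S xs , proj T xs ⟩
    interchange∘ρ⇐⊗id-cancel : ∀ {A B C} →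
                               ((id ⊗₁ id) ⊗₁ λ⇒) ∘ (interchange ∘ (ρ⇐ ⊗₁ id)) ≈ α⇐ {A} {B} {C}
    interchange∘ρ⇐⊗id-cancel = begin
      ((id ⊗₁ id) ⊗₁ λ⇒) ∘ (interchange ∘ (ρ⇐ ⊗₁ id))  ≈⟨ ∘ʳ interchange∘ρ⇐⊗id ⟩
      ((id ⊗₁ id) ⊗₁ λ⇒) ∘ (α⇐ ∘ (id ⊗₁ (id ⊗₁ λ⇐)))   ≈⟨ ∘ʳ α⇐-natural ⟩
      ((id ⊗₁ id) ⊗₁ λ⇒) ∘ (((id ⊗₁ id) ⊗₁ λ⇐) ∘ α⇐)   ≈⟨ pullˡ ∘-⊗ ⟩
      (((id ⊗₁ id) ∘ (id ⊗₁ id)) ⊗₁ (λ⇒ ∘ λ⇐)) ∘ α⇐    ≈⟨ ∘ˡ (⊗-resp-≈ id⊗id∘ λ-isoʳ) ⟩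
      ((id ⊗₁ id) ⊗₁ id) ∘ α⇐                          ≈⟨ ∘ˡ (trans (⊗ˡ ⊗-id) ⊗-id) ⟩
      id ∘ α⇐                                          ≈⟨ identityˡ ⟩
      α⇐ ∎
  sep∘proj≈pair (false ∷ S) (true ∷ T) (x ∷ xs) = begin
    (α⇒ ∘ ((σ ⊗₁ id) ∘ (α⇐ ∘ (id ⊗₁ sep S T xs)))) ∘ (id ⊗₁ proj (S ∪ T) xs)
      ≈⟨ trans assoc (∘ʳ (trans assoc (∘ʳ assoc))) ⟩
    α⇒ ∘ ((σ ⊗₁ id) ∘ (α⇐ ∘ ((id ⊗₁ sep S T xs) ∘ (id ⊗₁ proj (S ∪ T) xs))))
      ≈⟨ ∘ʳ (∘ʳ (∘ʳ (trans id⊗∘ (⊗ʳ (sep∘proj≈pair S T xs))))) ⟩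
    α⇒ ∘ ((σ ⊗₁ id) ∘ (α⇐ ∘ (id ⊗₁ proj-pair)))
      ≈⟨ trans (∘ʳ sym-assoc) sym-assoc ⟩
    swapˡ ∘ (id ⊗₁ proj-pair)
      ≈⟨ ∘ˡ interchange∘λ⇐⊗id-cancel ⟨
    ((λ⇒ ⊗₁ (id ⊗₁ id)) ∘ (interchange ∘ (λ⇐ ⊗₁ id))) ∘ (id ⊗₁ proj-pair)
      ≈⟨ trans assoc (∘ʳ assoc) ⟩
    (λ⇒ ⊗₁ (id ⊗₁ id)) ∘ (interchange ∘ ((λ⇐ ⊗₁ id) ∘ (id ⊗₁ proj-pair)))
      ≈⟨ ∘ʳ (∘ʳ (trans ∘-⊗ (⊗-resp-≈ (trans identityʳ (sym Δ-counitˡ)) identityˡ))) ⟩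
    (λ⇒ ⊗₁ (id ⊗₁ id)) ∘ (interchange ∘ (((ε ⊗₁ id) ∘ Δ) ⊗₁ proj-pair))
      ≈⟨ ∘ʳ pair-⊗ ⟨
    (λ⇒ ⊗₁ (id ⊗₁ id)) ∘ (((ε ⊗₁ proj S xs) ⊗₁ (id ⊗₁ proj T xs)) ∘ Δ)
      ≈⟨ pullˡ (trans ∘-⊗ (⊗ʳ id⊗id∘)) ⟩
    ((λ⇒ ∘ (ε ⊗₁ proj S xs)) ⊗₁ (id ⊗₁ proj T xs)) ∘ Δ ∎
    where
    proj-pair : Xall 𝒞 ec xs ⇒ Xₛ 𝒞 ec xs S ⊗₀ Xₛ 𝒞 ec xs T
    proj-pair = ⟨ proj S xs , proj T xs ⟩
    interchange∘λ⇐⊗id-cancel : ∀ {A B C} →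
                               (λ⇒ ⊗₁ (id ⊗₁ id)) ∘ (interchange ∘ (λ⇐ ⊗₁ id)) ≈ swapˡ {A} {B} {C}
    interchange∘λ⇐⊗id-cancel = begin
      (λ⇒ ⊗₁ (id ⊗₁ id)) ∘ (interchange ∘ (λ⇐ ⊗₁ id))  ≈⟨ ∘ʳ interchange∘λ⇐⊗id ⟩
      (λ⇒ ⊗₁ (id ⊗₁ id)) ∘ ((λ⇐ ⊗₁ id) ∘ swapˡ)        ≈⟨ pullˡ ∘-⊗ ⟩
      ((λ⇒ ∘ λ⇐) ⊗₁ ((id ⊗₁ id) ∘ id)) ∘ swapˡ         ≈⟨ ∘ˡ (⊗-resp-≈ λ-isoʳ (trans identityʳ ⊗-id)) ⟩
      (id ⊗₁ id) ∘ swapˡ                               ≈⟨ id⊗id∘ ⟩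
      swapˡ ∎
  sep∘proj≈pair (false ∷ S) (false ∷ T) (x ∷ xs) = begin
    sep S T xs ∘ (λ⇒ ∘ (ε ⊗₁ proj (S ∪ T) xs))
      ≈⟨ extendʳ λ-natural ⟨
    λ⇒ ∘ ((id ⊗₁ sep S T xs) ∘ (ε ⊗₁ proj (S ∪ T) xs))
      ≈⟨ ∘ʳ (trans ∘-⊗ (⊗-resp-≈ identityˡ (sep∘proj≈pair S T xs))) ⟩
    λ⇒ ∘ (ε ⊗₁ proj-pair)
      ≈⟨ ∘ʳ (trans ∘-⊗ (⊗-resp-≈ identityʳ identityˡ)) ⟨
    λ⇒ ∘ ((ε ⊗₁ id) ∘ (id ⊗₁ proj-pair))
      ≈⟨ pullˡ λ⇒⊗λ⇒∘interchange∘Δ⊗id≈λ⇒ ⟨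
    (λ⇒ ⊗₁ λ⇒) ∘ ((interchange ∘ (Δ ⊗₁ id)) ∘ ((ε ⊗₁ id) ∘ (id ⊗₁ proj-pair)))
      ≈⟨ ∘ʳ (trans assoc (∘ʳ (pullˡ ∘⊗id))) ⟩
    (λ⇒ ⊗₁ λ⇒) ∘ (interchange ∘ (((Δ ∘ ε) ⊗₁ id) ∘ (id ⊗₁ proj-pair)))
      ≈⟨ ∘ʳ (∘ʳ (trans ∘-⊗ (⊗-resp-≈ (trans identityʳ (sym ε⊗ε∘Δ≈Δ∘ε)) identityˡ))) ⟩
    (λ⇒ ⊗₁ λ⇒) ∘ (interchange ∘ (((ε ⊗₁ ε) ∘ Δ) ⊗₁ proj-pair))
      ≈⟨ ∘ʳ pair-⊗ ⟨
    (λ⇒ ⊗₁ λ⇒) ∘ (((ε ⊗₁ proj S xs) ⊗₁ (ε ⊗₁ proj T xs)) ∘ Δ)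
      ≈⟨ pullˡ ∘-⊗ ⟩
    ((λ⇒ ∘ (ε ⊗₁ proj S xs)) ⊗₁ (λ⇒ ∘ (ε ⊗₁ proj T xs))) ∘ Δ ∎
    where
    proj-pair : Xall 𝒞 ec xs ⇒ Xₛ 𝒞 ec xs S ⊗₀ Xₛ 𝒞 ec xs T
    proj-pair = ⟨ proj S xs , proj T xs ⟩

module SemiGraphoid {o ℓ e} (𝒞 : CDCategory o ℓ e) (ec : EffectConditioning 𝒞)
                    {n : ℕ} (Xs : Vec (CDCategory.Obj 𝒞) n)
                    (ω : CDCategory._⇒_ 𝒞 (CDCategory.I 𝒞) (Xall 𝒞 ec Xs)) where
  open CDCategory 𝒞
  open CDProperties 𝒞
  open Conditioning 𝒞 ec
  open RandomVariables ω
  open SubsetMaps 𝒞 ec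

  infix 4 _⊥⊥_∣_
  _⊥⊥_∣_ : Subset n → Subset n → Subset n → Set e
  A ⊥⊥ B ∣ C = CondIndep 𝒞 ec Xs ω A B C

  var : (S : Subset n) → Xall 𝒞 ec Xs ⇒ Xₛ 𝒞 ec Xs S
  var S = proj S Xs

  condOf≈given : ∀ S T → condOf 𝒞 ec Xs ω S T ≈ given (var S) (var T)
  condOf≈given S T = cond-resp (trans sym-assoc (∘ˡ (sep∘proj≈pair S T Xs)))

  sep∘condOf≈given : ∀ A B C → sep A B Xs ∘ condOf 𝒞 ec Xs ω (A ∪ B) C ≈ given ⟨ var A , var B ⟩ (var C)
  sep∘condOf≈given A B C =
    trans (∘ʳ (condOf≈given (A ∪ B) C))
          (trans (sym (given-post (sep-total A B Xs))) (given-resp (sep∘proj≈pair A B Xs)))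

  pair-condOf≈given : ∀ A B C → ⟨ condOf 𝒞 ec Xs ω A C , condOf 𝒞 ec Xs ω B C ⟩ ≈
                      ⟨ given (var A) (var C) , given (var B) (var C) ⟩
  pair-condOf≈given A B C = pair-resp (condOf≈given A C) (condOf≈given B C)

  ⊥⊥⇒Independent : ∀ A B C → A ⊥⊥ B ∣ C → Independent (var A) (var B) (var C)
  ⊥⊥⇒Independent A B C h =
    trans (sym (sep∘condOf≈given A B C)) (trans h (pair-condOf≈given A B C))

  Independent⇒⊥⊥ : ∀ A B C → Independent (var A) (var B) (var C) → A ⊥⊥ B ∣ C
  Independent⇒⊥⊥ A B C h =
    trans (sep∘condOf≈given A B C) (trans h (sym (pair-condOf≈given A B C)))

  join∘pair≈var : ∀ S T → Disjoint S T → join S T Xs ∘ ⟨ var S , var T ⟩ ≈ var (S ∪ T)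
  join∘pair≈var S T S∩T=∅ =
    trans (∘ʳ (sym (sep∘proj≈pair S T Xs)))
          (trans sym-assoc (trans (∘ˡ (join∘sep≈id S T Xs S∩T=∅)) identityˡ))

  ⊥⊥-∪⇒Independent-pair : ∀ A B C D → A ⊥⊥ B ∪ D ∣ C → Independent (var A) ⟨ var B , var D ⟩ (var C)
  ⊥⊥-∪⇒Independent-pair A B C D h =
    Independent-post (sep-total B D Xs) (sym (sep∘proj≈pair B D Xs)) (⊥⊥⇒Independent A (B ∪ D) C h)

  Independent-pair⇒⊥⊥-∪ : ∀ A B C D → Disjoint B D →
                          Independent (var A) ⟨ var B , var D ⟩ (var C) → A ⊥⊥ B ∪ D ∣ C
  Independent-pair⇒⊥⊥-∪ A B C D B∩D=∅ h =
    Independent⇒⊥⊥ A (B ∪ D) C (Independent-post (join-total B D Xs) (sym (join∘pair≈var B D B∩D=∅)) h)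

  module Joint (C D : Subset n) (C∩D=∅ : Disjoint C D) =
    JointConditioning (sep∘proj≈pair C D Xs) (join∘pair≈var C D C∩D=∅)
      (proj-total D Xs) (proj-deterministic C Xs) (proj-deterministic (C ∪ D) Xs)

  symmetry : ∀ A B C → A ⊥⊥ B ∣ C → B ⊥⊥ A ∣ C
  symmetry A B C h = Independent⇒⊥⊥ B A C (Independent-sym (⊥⊥⇒Independent A B C h))

  decomposition : ∀ A B C D → A ⊥⊥ B ∪ D ∣ C → A ⊥⊥ B ∣ C × A ⊥⊥ D ∣ C
  decomposition A B C D h =
    map (Independent⇒⊥⊥ A B C) (Independent⇒⊥⊥ A D C)
        (Independent-decomposition (proj-total B Xs) (proj-total D Xs) (⊥⊥-∪⇒Independent-pair A B C D h))

  weak-union : ∀ A B C D → Disjoint C D → A ⊥⊥ B ∪ D ∣ C → A ⊥⊥ B ∣ C ∪ D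
  weak-union A B C D C∩D=∅ h =
    Independent⇒⊥⊥ A B (C ∪ D) (Joint.weak-union C D C∩D=∅ (proj-total A Xs) (proj-total B Xs)
                                 (⊥⊥-∪⇒Independent-pair A B C D h))

  contraction : ∀ A B C D → Disjoint B D → Disjoint C D →
                A ⊥⊥ B ∣ C ∪ D → A ⊥⊥ D ∣ C → A ⊥⊥ B ∪ D ∣ C
  contraction A B C D B∩D=∅ C∩D=∅ h₁ h₂ =
    Independent-pair⇒⊥⊥-∪ A B C D B∩D=∅
      (Joint.contraction C D C∩D=∅ (proj-total A Xs) (proj-total B Xs)
        (⊥⊥⇒Independent A B (C ∪ D) h₁) (⊥⊥⇒Independent A D C h₂))

theorem2p19 : ∀ {o ℓ e} (𝒞 : CDCategory o ℓ e) (ec : EffectConditioning 𝒞)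
    {n : ℕ} (Xs : Vec (CDCategory.Obj 𝒞) n)
    (ω : CDCategory._⇒_ 𝒞 (CDCategory.I 𝒞) (Xall 𝒞 ec Xs))
    (A B C D : Subset n) →
    Disjoint A B → Disjoint A C → Disjoint A D →
    Disjoint B C → Disjoint B D → Disjoint C D →
    -- Symmetry
    (CondIndep 𝒞 ec Xs ω A B C ⇔ CondIndep 𝒞 ec Xs ω B A C)
    -- Decomposition
    × (CondIndep 𝒞 ec Xs ω A (B ∪ D) C →
         CondIndep 𝒞 ec Xs ω A B C × CondIndep 𝒞 ec Xs ω A D C)
    -- Weak union
    × (CondIndep 𝒞 ec Xs ω A (B ∪ D) C → CondIndep 𝒞 ec Xs ω A B (C ∪ D))
    -- Contraction
    × (CondIndep 𝒞 ec Xs ω A B (C ∪ D) → CondIndep 𝒞 ec Xs ω A D C →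
         CondIndep 𝒞 ec Xs ω A (B ∪ D) C)
theorem2p19 𝒞 ec Xs ω A B C D _ _ _ _ B∩D=∅ C∩D=∅ =
    mk⇔ (symmetry A B C) (symmetry B A C)
  , decomposition A B C D
  , weak-union A B C D C∩D=∅
  , contraction A B C D B∩D=∅ C∩D=∅
  where open SemiGraphoid 𝒞 ec Xs ω
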